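{- Let $k\ge 2$. In the game described in the context (starting from the empty board), Builder has a strategy such that, against every strategy of Painter, at least one of the following occurs: a red $P_3$ or a blue $P_3$ appears within the first $6k-1$ rounds; or after at most $6k-2$ rounds the board contains a bad green $P_{4k}$; or after at most $6k-1$ rounds the board contains a good green $P_{4k}$.
   Context: $P_m$ denotes the path on $m$ vertices. Game: Builder and Painter play on an infinite vertex set, initially with no edges; in each round Builder draws an edge between two nonadjacent vertices and Painter immediately colors it red, blue or green. A green path is a path all of whose edges are green. A green path is called good if at least one of its endpoints is incident to a red or blue edge, and bad otherwise. -}

module Defs where

open import Data.Nat using (ℕ; zero; suc)
open import Data.Product using (Σ; ∃; _×_; _,_; proj₁)
open import Data.Sum using (_⊎_)
open import Data.List using (List; []; _∷_; head; last; length)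
open import Data.List.Membership.Propositional using (_∈_)
open import Data.List.Relation.Unary.Unique.Propositional using (Unique)
open import Data.List.Relation.Unary.Linked using (Linked)
open import Data.Maybe using (just)
open import Relation.Nullary using (¬_)
open import Relation.Binary.PropositionalEquality using (_≡_; _≢_)

data Colour : Set where
  red blue green : Colour

Vertex : Set
Vertex = ℕ

-- A coloured edge: (u , v , c) is an edge uv of colour c (unordered; see HasEdge).
ColouredEdge : Set
ColouredEdge = Vertex × Vertex × Colour

-- A board is the (finite) list of coloured edges drawn so far (most recent first).
Board : Set
Board = List ColouredEdge

HasEdge : Board → Colour → Vertex → Vertex → Set
HasEdge b c u v = ((u , v , c) ∈ b) ⊎ ((v , u , c) ∈ b)

Adjacent : Board → Vertex → Vertex → Set
Adjacent b u v = ∃ λ c → HasEdge b c u v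

LegalMove : Board → Set
LegalMove b = Σ (Vertex × Vertex) λ { (u , v) → (u ≢ v) × ¬ Adjacent b u v }

BuilderStrategy : Set
BuilderStrategy = (b : Board) → LegalMove b

PainterStrategy : Set
PainterStrategy = Board → Vertex × Vertex → Colour

play : BuilderStrategy → PainterStrategy → ℕ → Board
play B P zero = []
play B P (suc t) with proj₁ (B (play B P t))
... | (u , v) = (u , v , P (play B P t) (u , v)) ∷ play B P t

-- vs is a path (listed in order) all of whose edges have colour c.
-- Its number of vertices is length vs.
MonoPath : Board → Colour → List Vertex → Set
MonoPath b c vs = Unique vs × Linked (HasEdge b c) vs

IsEndpoint : List Vertex → Vertex → Set
IsEndpoint vs x = (head vs ≡ just x) ⊎ (last vs ≡ just x)

TouchesRedOrBlue : Board → Vertex → Set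
TouchesRedOrBlue b x = (∃ λ y → HasEdge b red x y) ⊎ (∃ λ y → HasEdge b blue x y)

HasMonoPath : Board → Colour → ℕ → Set
HasMonoPath b c m = ∃ λ vs → MonoPath b c vs × length vs ≡ m

HasGoodGreenPath : Board → ℕ → Set
HasGoodGreenPath b m = ∃ λ vs → MonoPath b green vs × length vs ≡ m
  × ∃ λ x → IsEndpoint vs x × TouchesRedOrBlue b x

HasBadGreenPath : Board → ℕ → Set
HasBadGreenPath b m = ∃ λ vs → MonoPath b green vs × length vs ≡ m
  × ((x : Vertex) → IsEndpoint vs x → ¬ TouchesRedOrBlue b x)

module Submission where

-- Builder grows a single green path, four vertices per phase, and Painter can stop a phase only
-- by completing a red or blue P₃. Let s = 1 if an end of the path is known to touch a red or blue
-- edge and s = 2 otherwise. The opening phase builds a green P₈ by a round t with t + s ≤ 12, and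
-- a phase extending a green P_{4j} built by a round t with t + s ≤ 6j ends with a green P_{4j+4}
-- by a round t′ with t′ + s′ ≤ 6(j + 1), or with a red or blue P₃ by round 6(j + 1) − 1. At j = k
-- this gives the deadlines 6k − 2 for a bad and 6k − 1 for a good green P_{4k}.
-- Each phase is a finite game, and Builder's strategy for it is a decision tree found by computer
-- search. The trees are written in local indices (the two path ends and the fresh vertices),
-- certified by evaluating a decision procedure, and the certificate is transported to the real
-- board along the injective map from local indices to vertices.

open import Defs
open import Data.Nat using (ℕ; _≤_; _*_; _∸_; zero; suc; _+_; _<_; _<?_; _≤?_; _⊔_; z≤n; s≤s)
open import Data.Nat.Properties
  using (_≟_; ≤-trans; <-≤-trans; <⇒≢; <⇒≱; <-irrefl; n<1+n; n≤1+n; m≤m+n; m≤m⊔n; m≤n⊔m;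
         +-assoc; +-comm; +-suc; +-identityʳ; +-cancelˡ-≡; +-monoʳ-≤; +-monoˡ-≤; +-monoʳ-<;
         *-suc; *-monoʳ-≤; m+n≤o⇒m≤o∸n; +-commutativeSemigroup; module ≤-Reasoning)
open import Data.Product using (Σ; ∃; ∃₂; _×_; _,_; proj₁; proj₂; swap)
open import Data.Sum using (_⊎_; inj₁; inj₂; [_,_]′)
open import Data.Empty using (⊥; ⊥-elim)
open import Data.Unit using (⊤; tt)
open import Data.Maybe using (Maybe; just; nothing)
open import Data.Maybe.Properties using (just-injective)
open import Data.List using (List; []; _∷_; _++_; map; length; head; last)
open import Data.List.Properties using (map-++; length-++; length-map; ++-assoc; ++-identityʳ)
open import Data.List.Membership.Propositional using (_∈_; find; lose)
open import Data.List.Membership.Propositional.Properties using (∈-map⁺; ∈-map⁻; ∈-++⁺ˡ; ∈-++⁺ʳ; ∈-++⁻)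
open import Data.List.Relation.Binary.Subset.Propositional using (_⊆_)
open import Data.List.Relation.Unary.Any using (Any; here; there; any?)
open import Data.List.Relation.Unary.All as All using (All; []; _∷_; all?)
import Data.List.Relation.Unary.All.Properties as All
open import Data.List.Relation.Unary.AllPairs using ([]; _∷_)
open import Data.List.Relation.Unary.Linked as Linked using (Linked; []; [-]; _∷_; linked?)
import Data.List.Relation.Unary.Linked.Properties as Linked
open import Data.List.Relation.Unary.Unique.Propositional using (Unique)
import Data.List.Relation.Unary.Unique.Propositional.Properties as Unique
open import Data.List.Relation.Unary.Unique.DecPropositional _≟_ using (unique?)
open import Data.List.Relation.Binary.Disjoint.Propositional using (Disjoint)
open import Data.List.Relation.Binary.Disjoint.DecPropositional _≟_ using (disjoint?)
open import Function using (_∘_)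
open import Relation.Binary.Definitions using (DecidableEquality)
open import Relation.Binary.PropositionalEquality using (_≡_; _≢_; refl; sym; trans; cong; cong₂; subst; ≢-sym; module ≡-Reasoning)
open import Relation.Nullary using (¬_; Dec; yes; no)
open import Relation.Nullary.Decidable using (_×-dec_; _⊎-dec_; ¬?; map′; from-yes)
open import Relation.Unary using (Decidable)
open import Algebra.Properties.CommutativeSemigroup +-commutativeSemigroup using (x∙yz≈y∙xz)
import Data.Product.Properties as Product
import Data.List.Membership.DecPropositional as DecMembership

_≟ᶜ_ : DecidableEquality Colour
red ≟ᶜ red = yes refl
red ≟ᶜ blue = no λ ()
red ≟ᶜ green = no λ ()
blue ≟ᶜ red = no λ ()
blue ≟ᶜ blue = yes refl
blue ≟ᶜ green = no λ ()
green ≟ᶜ red = no λ ()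
green ≟ᶜ blue = no λ ()
green ≟ᶜ green = yes refl

open DecMembership (Product.≡-dec _≟_ (Product.≡-dec _≟_ _≟ᶜ_)) using (_∈?_)

hasEdge? : ∀ b c u v → Dec (HasEdge b c u v)
hasEdge? b c u v = ((u , v , c) ∈? b) ⊎-dec ((v , u , c) ∈? b)

∃-colour? : {P : Colour → Set} → Decidable P → Dec (∃ P)
∃-colour? P? with P? red | P? blue | P? green
... | yes p | _ | _ = yes (red , p)
... | _ | yes p | _ = yes (blue , p)
... | _ | _ | yes p = yes (green , p)
... | no ¬r | no ¬b | no ¬g = no λ { (red , p) → ¬r p ; (blue , p) → ¬b p ; (green , p) → ¬g p }

adjacent? : ∀ b u v → Dec (Adjacent b u v)
adjacent? b u v = ∃-colour? λ c → hasEdge? b c u v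

Legal : Board → Vertex → Vertex → Set
Legal b u v = u ≢ v × ¬ Adjacent b u v

legal? : ∀ b u v → Dec (Legal b u v)
legal? b u v = ¬? (u ≟ v) ×-dec ¬? (adjacent? b u v)

IncidentWith : (Vertex → Set) → Colour → Vertex → ColouredEdge → Set
IncidentWith Q c x (u , v , c′) = c′ ≡ c × ((u ≡ x × Q v) ⊎ (v ≡ x × Q u))

incident? : {Q : Vertex → Set} → Decidable Q → ∀ b c x → Dec (∃ λ y → Q y × HasEdge b c x y)
incident? {Q} Q? b c x = map′ sound complete (any? incidentWith? b)
  where
  incidentWith? : Decidable (IncidentWith Q c x)
  incidentWith? (u , v , c′) = (c′ ≟ᶜ c) ×-dec (((u ≟ x) ×-dec Q? v) ⊎-dec ((v ≟ x) ×-dec Q? u))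
  sound : Any (IncidentWith Q c x) b → ∃ λ y → Q y × HasEdge b c x y
  sound p with find p
  ... | (u , v , c′) , e∈b , refl , inj₁ (refl , q) = v , q , inj₁ e∈b
  ... | (u , v , c′) , e∈b , refl , inj₂ (refl , q) = u , q , inj₂ e∈b
  complete : (∃ λ y → Q y × HasEdge b c x y) → Any (IncidentWith Q c x) b
  complete (y , q , inj₁ e∈b) = lose e∈b (refl , inj₁ (refl , q))
  complete (y , q , inj₂ e∈b) = lose e∈b (refl , inj₂ (refl , q))

touchesRedOrBlue? : ∀ b x → Dec (TouchesRedOrBlue b x)
touchesRedOrBlue? b x = edgeAt? red ⊎-dec edgeAt? blue
  where
  edgeAt? : ∀ c → Dec (∃ λ y → HasEdge b c x y)
  edgeAt? c = map′ (λ (y , _ , e) → y , e) (λ (y , e) → y , tt , e) (incident? (λ _ → yes tt) b c x)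

Pendant : Board → Colour → Vertex → Vertex → Set
Pendant b c x z = ∃ λ y → (y ≢ x × y ≢ z) × HasEdge b c x y

pendant? : ∀ b c x z → Dec (Pendant b c x z)
pendant? b c x z = incident? (λ y → ¬? (y ≟ x) ×-dec ¬? (y ≟ z)) b c x

HasEdge-sym : ∀ {b c x y} → HasEdge b c x y → HasEdge b c y x
HasEdge-sym (inj₁ e) = inj₂ e
HasEdge-sym (inj₂ e) = inj₁ e

HasEdge-⊆ : ∀ {b b′ c x y} → b ⊆ b′ → HasEdge b c x y → HasEdge b′ c x y
HasEdge-⊆ b⊆b′ (inj₁ e) = inj₁ (b⊆b′ e)
HasEdge-⊆ b⊆b′ (inj₂ e) = inj₂ (b⊆b′ e)

Pendant-⊆ : ∀ {b b′ c x z} → b ⊆ b′ → Pendant b c x z → Pendant b′ c x z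
Pendant-⊆ b⊆b′ (y , y∉xz , e) = y , y∉xz , HasEdge-⊆ b⊆b′ e

pendant⇒P3 : ∀ {b c x z} → x ≢ z → Pendant b c x z → HasEdge b c x z → HasMonoPath b c 3
pendant⇒P3 {x = x} {z} x≢z (y , (y≢x , y≢z) , xy) xz =
  (y ∷ x ∷ z ∷ []) , (((y≢x ∷ y≢z ∷ []) ∷ (x≢z ∷ []) ∷ [] ∷ []) , (HasEdge-sym xy ∷ xz ∷ [-])) , refl

RedOrBlueP3 : Board → Set
RedOrBlueP3 b = HasMonoPath b red 3 ⊎ HasMonoPath b blue 3

redOrBlueP3 : ∀ {b c} → c ≢ green → HasMonoPath b c 3 → RedOrBlueP3 b
redOrBlueP3 {c = red} _ p = inj₁ p
redOrBlueP3 {c = blue} _ p = inj₂ p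
redOrBlueP3 {c = green} c≢green _ = ⊥-elim (c≢green refl)

VerticesBelow : ℕ → Board → Set
VerticesBelow n b = ∀ {u v c} → (u , v , c) ∈ b → u < n × v < n

HasEdge-below : ∀ {n b c x y} → VerticesBelow n b → HasEdge b c x y → x < n × y < n
HasEdge-below below (inj₁ e) = below e
HasEdge-below below (inj₂ e) = let (y<n , x<n) = below e in x<n , y<n

maxVertex : Board → Vertex
maxVertex [] = 0
maxVertex ((u , v , _) ∷ b) = u ⊔ v ⊔ maxVertex b

below-maxVertex : ∀ b → VerticesBelow (suc (maxVertex b)) b
below-maxVertex ((u , v , _) ∷ b) (here refl) =
  s≤s (≤-trans (m≤m⊔n u v) (m≤m⊔n (u ⊔ v) (maxVertex b))) ,
  s≤s (≤-trans (m≤n⊔m u v) (m≤m⊔n (u ⊔ v) (maxVertex b)))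
below-maxVertex ((u , v , _) ∷ b) (there e) =
  let (u′< , v′<) = below-maxVertex b e in raise u′< , raise v′<
  where
  raise : ∀ {w} → w < suc (maxVertex b) → w < suc (u ⊔ v ⊔ maxVertex b)
  raise w< = <-≤-trans w< (s≤s (m≤n⊔m (u ⊔ v) (maxVertex b)))

-- Builder's move once its tree proposes nothing (the game is decided) or an illegal edge (never on the actual play).
freshMove : (b : Board) → LegalMove b
freshMove b = (n , suc n) , <⇒≢ (n<1+n n) , λ (_ , e) → <-irrefl refl (proj₁ (HasEdge-below (below-maxVertex b) e))
  where
  n = suc (maxVertex b)

module _ {A : Set} where

  headOr : A → List A → A
  headOr d [] = d
  headOr d (x ∷ _) = x

  lastOr : A → List A → A
  lastOr d [] = d
  lastOr d (x ∷ xs) = lastOr x xs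

  headOr-All : ∀ {P : A → Set} {d} xs → P d → All P xs → P (headOr d xs)
  headOr-All [] pd _ = pd
  headOr-All (x ∷ xs) _ (px ∷ _) = px

  lastOr-All : ∀ {P : A → Set} {d} xs → P d → All P xs → P (lastOr d xs)
  lastOr-All [] pd _ = pd
  lastOr-All (x ∷ xs) _ (px ∷ pxs) = lastOr-All xs px pxs

  last-++ : ∀ xs {ys} {y : A} → last ys ≡ just y → last (xs ++ ys) ≡ just y
  last-++ [] eq = eq
  last-++ (x ∷ []) {[]} ()
  last-++ (x ∷ []) {_ ∷ _} eq = eq
  last-++ (x ∷ x′ ∷ xs) eq = last-++ (x′ ∷ xs) eq

  Linked-glueˡ : ∀ {R : A → A → Set} xs {x ys} → Linked R (xs ++ x ∷ []) → Linked R (x ∷ ys) → Linked R (xs ++ x ∷ ys)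
  Linked-glueˡ [] _ r = r
  Linked-glueˡ (_ ∷ []) (e ∷ [-]) r = e ∷ r
  Linked-glueˡ (_ ∷ y ∷ xs) (e ∷ l) r = e ∷ Linked-glueˡ (y ∷ xs) l r

  Linked-glueʳ : ∀ {R : A → A → Set} {xs x ys} → Linked R xs → last xs ≡ just x → Linked R (x ∷ ys) → Linked R (xs ++ ys)
  Linked-glueʳ [-] refl r = r
  Linked-glueʳ (e ∷ l) eq r = e ∷ Linked-glueʳ l eq r

module _ {A B : Set} (f : A → B) where

  head-map-++ : ∀ {d} xs {ys} → head ys ≡ just (f d) → head (map f xs ++ ys) ≡ just (f (headOr d xs))
  head-map-++ [] eq = eq
  head-map-++ (x ∷ xs) _ = refl

  last-++-map : ∀ {d} xs ys → last xs ≡ just (f d) → last (xs ++ map f ys) ≡ just (f (lastOr d ys))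
  last-++-map xs [] eq = trans (cong last (++-identityʳ xs)) eq
  last-++-map xs (y ∷ ys) _ =
    trans (cong last (sym (++-assoc xs (f y ∷ []) (map f ys)))) (last-++-map (xs ++ f y ∷ []) ys (last-++ xs refl))

-- Phases and their certificates

data End : Set where
  front back : End

data RedOrBlue : Set where
  red blue : RedOrBlue

paint : RedOrBlue → Colour
paint red = red
paint blue = blue

-- What is known about the green path when a phase starts: marked e c says that its end e has a
-- c-coloured edge, so the path is good.
data Knowledge : Set where
  bare : Knowledge
  marked : End → RedOrBlue → Knowledge

data Phase : Set where
  opening : Phase
  extending : Knowledge → Phase

-- A Builder strategy for one phase. ask i j draws the edge between local vertices i and j and
-- continues according to its colour; p3 means Painter's last colour closed a red or blue P₃;
-- extend k pre suf m ends the phase with the green path pre ++ (old path) ++ suf, having used m fresh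
-- vertices, and found k path m ends the opening phase with a new green path.
data Tree : Set where
  ask : ℕ → ℕ → (onRed onBlue onGreen : Tree) → Tree
  p3 : Tree
  extend : Knowledge → (prefix suffix : List ℕ) → (newVertices : ℕ) → Tree
  found : Knowledge → (path : List ℕ) → (newVertices : ℕ) → Tree

select : {A : Set} → End → A → A → A
select front s t = s
select back s t = t

-- Local index 0 and 1 name the ends of the current green path, index 2 + i the i-th vertex
-- never used before the current phase; a local board uses local indices for its vertices.
record Frame : Set where
  constructor mkFrame
  field
    start finish fresh : Vertex
open Frame

vertexAt : Frame → ℕ → Vertex
vertexAt F zero = start F
vertexAt F (suc zero) = finish F
vertexAt F (suc (suc i)) = fresh F + i

FrameOK : Frame → Set
FrameOK F = start F ≢ finish F × start F < fresh F × finish F < fresh F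

endpoint : Frame → End → Vertex
endpoint F e = select e (start F) (finish F)

nextFrame : Frame → (s f m : ℕ) → Frame
nextFrame F s f m = mkFrame (vertexAt F s) (vertexAt F f) (fresh F + m)

embed : Frame → Board → Board
embed F = map λ (i , j , c) → vertexAt F i , vertexAt F j , c

old≢new : ∀ {x n} i → x < n → x ≢ n + i
old≢new i x<n = <⇒≢ (<-≤-trans x<n (m≤m+n _ i))

vertexAt-injective : ∀ {F} → FrameOK F → ∀ {i j} → vertexAt F i ≡ vertexAt F j → i ≡ j
vertexAt-injective _ {0} {0} _ = refl
vertexAt-injective (s≢f , _) {0} {1} eq = ⊥-elim (s≢f eq)
vertexAt-injective (_ , s< , _) {0} {suc (suc j)} eq = ⊥-elim (old≢new j s< eq)
vertexAt-injective (s≢f , _) {1} {0} eq = ⊥-elim (s≢f (sym eq))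
vertexAt-injective _ {1} {1} _ = refl
vertexAt-injective (_ , _ , f<) {1} {suc (suc j)} eq = ⊥-elim (old≢new j f< eq)
vertexAt-injective (_ , s< , _) {suc (suc i)} {0} eq = ⊥-elim (old≢new i s< (sym eq))
vertexAt-injective (_ , _ , f<) {suc (suc i)} {1} eq = ⊥-elim (old≢new i f< (sym eq))
vertexAt-injective {F} _ {suc (suc i)} {suc (suc j)} eq = cong (suc ∘ suc) (+-cancelˡ-≡ (fresh F) i j eq)

vertexAt-fresh : ∀ F {i} → 2 ≤ i → fresh F ≤ vertexAt F i
vertexAt-fresh F {0} ()
vertexAt-fresh F {1} (s≤s ())
vertexAt-fresh F {suc (suc i)} _ = m≤m+n (fresh F) i

vertexAt-old : ∀ F {i} → vertexAt F i < fresh F → i < 2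
vertexAt-old F {0} _ = s≤s z≤n
vertexAt-old F {1} _ = s≤s (s≤s z≤n)
vertexAt-old F {suc (suc i)} v< = ⊥-elim (<⇒≱ v< (vertexAt-fresh F {suc (suc i)} (s≤s (s≤s z≤n))))

vertexAt-< : ∀ {F} → FrameOK F → ∀ {m i} → i < 2 + m → vertexAt F i < fresh F + m
vertexAt-< {F} (_ , s< , _) {m} {0} _ = <-≤-trans s< (m≤m+n (fresh F) m)
vertexAt-< {F} (_ , _ , f<) {m} {1} _ = <-≤-trans f< (m≤m+n (fresh F) m)
vertexAt-< {F} _ {i = suc (suc i)} (s≤s (s≤s i<m)) = +-monoʳ-< (fresh F) i<m

-- budget counts the rounds a phase may use, including the slack it must leave for the next one.
slack : Knowledge → ℕ
slack bare = 2
slack (marked _ _) = 1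

budget : Phase → ℕ
budget opening = 12
budget (extending k) = slack k + 6

MarkedAt : Phase → ℕ → Colour → Set
MarkedAt (extending (marked e c)) x c′ = x ≡ select e 0 1 × paint c ≡ c′
MarkedAt _ _ _ = ⊥

markedAt? : ∀ ph x c → Dec (MarkedAt ph x c)
markedAt? opening x c = no λ ()
markedAt? (extending bare) x c = no λ ()
markedAt? (extending (marked e c)) x c′ = (x ≟ select e 0 1) ×-dec (paint c ≟ᶜ c′)

Touches : Phase → Board → ℕ → Colour → Set
Touches ph lb x c = MarkedAt ph x c ⊎ Pendant lb c x x

touches? : ∀ ph lb x c → Dec (Touches ph lb x c)
touches? ph lb x c = markedAt? ph x c ⊎-dec pendant? lb c x x

Justified : Phase → Board → ℕ → ℕ → Knowledge → Set
Justified ph lb s f bare = ⊤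
Justified ph lb s f (marked e c) = Touches ph lb (select e s f) (paint c)

justified? : ∀ ph lb s f k → Dec (Justified ph lb s f k)
justified? ph lb s f bare = yes tt
justified? ph lb s f (marked e c) = touches? ph lb (select e s f) (paint c)

ClosesP3 : Phase → Board → ℕ → ℕ → Colour → Set
ClosesP3 ph lb i j c = Pendant lb c i j ⊎ Pendant lb c j i ⊎ (MarkedAt ph i c × 2 ≤ j) ⊎ (MarkedAt ph j c × 2 ≤ i)

closesP3? : ∀ ph lb i j c → Dec (ClosesP3 ph lb i j c)
closesP3? ph lb i j c = pendant? lb c i j ⊎-dec pendant? lb c j i
  ⊎-dec (markedAt? ph i c ×-dec 2 ≤? j) ⊎-dec (markedAt? ph j c ×-dec 2 ≤? i)

LastMoveClosesP3 : Phase → Board → Set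
LastMoveClosesP3 ph [] = ⊥
LastMoveClosesP3 ph ((i , j , c) ∷ lb) = i ≢ j × c ≢ green × ClosesP3 ph lb i j c

lastMoveClosesP3? : ∀ ph lb → Dec (LastMoveClosesP3 ph lb)
lastMoveClosesP3? ph [] = no λ ()
lastMoveClosesP3? ph ((i , j , c) ∷ lb) = ¬? (i ≟ j) ×-dec ¬? (c ≟ᶜ green) ×-dec closesP3? ph lb i j c

Fresh : ℕ → ℕ → Set
Fresh m i = 2 ≤ i × i < 2 + m

fresh? : ∀ m i → Dec (Fresh m i)
fresh? m i = 2 ≤? i ×-dec i <? 2 + m

Within : ℕ → ColouredEdge → Set
Within m (i , j , _) = i < 2 + m × j < 2 + m

within? : ∀ m e → Dec (Within m e)
within? m (i , j , _) = i <? 2 + m ×-dec j <? 2 + m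

Extension : ℕ → Board → List ℕ → List ℕ → Set
Extension m lb pre suf = All (Fresh m) pre × All (Fresh m) suf × Unique pre × Unique suf × Disjoint pre suf
  × Linked (HasEdge lb green) (pre ++ 0 ∷ []) × Linked (HasEdge lb green) (1 ∷ suf) × length pre + length suf ≡ 4

extension? : ∀ m lb pre suf → Dec (Extension m lb pre suf)
extension? m lb pre suf = all? (fresh? m) pre ×-dec all? (fresh? m) suf ×-dec unique? pre ×-dec unique? suf
  ×-dec disjoint? pre suf ×-dec linked? (hasEdge? lb green) (pre ++ 0 ∷ []) ×-dec linked? (hasEdge? lb green) (1 ∷ suf)
  ×-dec length pre + length suf ≟ 4

FreshPath : ℕ → Board → List ℕ → Set
FreshPath m lb path = All (Fresh m) path × Unique path × Linked (HasEdge lb green) path × length path ≡ 8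

freshPath? : ∀ m lb path → Dec (FreshPath m lb path)
freshPath? m lb path = all? (fresh? m) path ×-dec unique? path ×-dec linked? (hasEdge? lb green) path ×-dec length path ≟ 8

Leaf : Phase → Board → ℕ → ℕ → ℕ → Knowledge → Set
Leaf ph lb s f m k = length lb + slack k ≤ budget ph × All (Within m) lb × s ≢ f × Justified ph lb s f k

leaf? : ∀ ph lb s f m k → Dec (Leaf ph lb s f m k)
leaf? ph lb s f m k = length lb + slack k ≤? budget ph ×-dec all? (within? m) lb ×-dec ¬? (s ≟ f) ×-dec justified? ph lb s f k

-- Builder never joins the two path ends: their adjacency is not recorded on the local board.
Valid : Phase → Board → Tree → Set
Valid ph lb (ask i j r b g) = (Legal lb i j × ¬ (i < 2 × j < 2))
  × Valid ph ((i , j , red) ∷ lb) r × Valid ph ((i , j , blue) ∷ lb) b × Valid ph ((i , j , green) ∷ lb) g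
Valid ph lb p3 = length lb + 1 ≤ budget ph × LastMoveClosesP3 ph lb
Valid opening lb (extend _ _ _ _) = ⊥
Valid (extending k₀) lb (extend k pre suf m) =
  Extension m lb pre suf × Leaf (extending k₀) lb (headOr 0 pre) (lastOr 1 suf) m k
Valid opening lb (found k path m) = FreshPath m lb path × Leaf opening lb (headOr 0 path) (lastOr 0 path) m k
Valid (extending _) lb (found _ _ _) = ⊥

valid? : ∀ ph lb tr → Dec (Valid ph lb tr)
valid? ph lb (ask i j r b g) = (legal? lb i j ×-dec ¬? (i <? 2 ×-dec j <? 2))
  ×-dec valid? ph ((i , j , red) ∷ lb) r ×-dec valid? ph ((i , j , blue) ∷ lb) b ×-dec valid? ph ((i , j , green) ∷ lb) g
valid? ph lb p3 = length lb + 1 ≤? budget ph ×-dec lastMoveClosesP3? ph lb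
valid? opening lb (extend _ _ _ _) = no λ ()
valid? (extending k₀) lb (extend k pre suf m) =
  extension? m lb pre suf ×-dec leaf? (extending k₀) lb (headOr 0 pre) (lastOr 1 suf) m k
valid? opening lb (found k path m) = freshPath? m lb path ×-dec leaf? opening lb (headOr 0 path) (lastOr 0 path) m k
valid? (extending _) lb (found _ _ _) = no λ ()

openingTree : Tree
openingTree = (ask 2 3 (ask 2 4 p3 (ask 2 5 p3 p3 (ask 2 6 p3 p3 (ask 3 4 p3 p3 (ask 3 7 p3 (ask 3 5 p3 p3 (ask 7 8 (ask 4 8 p3 p3 (ask 6 7 p3 p3 (ask 7 9 p3 p3 (found (marked front red) (8 ∷ 4 ∷ 3 ∷ 5 ∷ 2 ∷ 6 ∷ 7 ∷ 9 ∷ []) 8)))) p3 (ask 4 9 (ask 4 8 p3 p3 (ask 7 9 p3 p3 (found (marked back red) (6 ∷ 2 ∷ 5 ∷ 3 ∷ 4 ∷ 8 ∷ 7 ∷ 9 ∷ []) 8))) p3 (ask 6 7 (ask 9 7 p3 p3 (found (marked front red) (6 ∷ 2 ∷ 5 ∷ 3 ∷ 4 ∷ 9 ∷ 7 ∷ 8 ∷ []) 8)) p3 (found bare (8 ∷ 7 ∷ 6 ∷ 2 ∷ 5 ∷ 3 ∷ 4 ∷ 9 ∷ []) 8))))) (ask 7 8 (ask 4 8 p3 p3 (ask 7 9 p3 (ask 5 7 p3 p3 (ask 8 9 p3 p3 (found (marked back blue) (6 ∷ 2 ∷ 5 ∷ 7 ∷ 3 ∷ 4 ∷ 8 ∷ 9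 ∷ []) 8))) (ask 5 8 p3 (ask 6 8 p3 p3 (found (marked front blue) (5 ∷ 2 ∷ 6 ∷ 8 ∷ 4 ∷ 3 ∷ 7 ∷ 9 ∷ []) 8)) (found bare (6 ∷ 2 ∷ 5 ∷ 8 ∷ 4 ∷ 3 ∷ 7 ∷ 9 ∷ []) 8)))) (ask 4 8 (ask 4 5 p3 p3 (ask 6 8 p3 p3 (ask 8 9 p3 p3 (found (marked front blue) (7 ∷ 3 ∷ 4 ∷ 5 ∷ 2 ∷ 6 ∷ 8 ∷ 9 ∷ []) 8)))) p3 (ask 7 9 (ask 5 7 p3 p3 (ask 8 9 p3 p3 (found (marked back red) (6 ∷ 2 ∷ 5 ∷ 7 ∷ 3 ∷ 4 ∷ 8 ∷ 9 ∷ []) 8))) p3 (ask 5 8 (ask 6 8 p3 p3 (found (marked front red) (5 ∷ 2 ∷ 6 ∷ 8 ∷ 4 ∷ 3 ∷ 7 ∷ 9 ∷ []) 8)) p3 (found bare (6 ∷ 2 ∷ 5 ∷ 8 ∷ 4 ∷ 3 ∷ 7 ∷ 9 ∷ []) 8)))) (ask 8 5 (ask 8 6 p3 (ask 4 5 p3 p3 (ask 8 9 p3 p3 (found (marked front blue) (6 ∷ 2 ∷ 5 ∷ 4 ∷ 3 ∷ 7 ∷ 8 ∷ 9 ∷ []) 8))) (ask 4 9 (ask 4 10 p3 p3 (found (marked front red) (5 ∷ 2 ∷ 6 ∷ 8 ∷ 7 ∷ 3 ∷ 4 ∷ 10 ∷ []) 9)) p3 (found bare (5 ∷ 2 ∷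 6 ∷ 8 ∷ 7 ∷ 3 ∷ 4 ∷ 9 ∷ []) 8))) (ask 4 6 (ask 4 9 p3 p3 (ask 6 8 p3 p3 (found (marked front blue) (5 ∷ 2 ∷ 6 ∷ 8 ∷ 7 ∷ 3 ∷ 4 ∷ 9 ∷ []) 8))) p3 (ask 5 9 (ask 5 10 p3 p3 (found (marked front blue) (8 ∷ 7 ∷ 3 ∷ 4 ∷ 6 ∷ 2 ∷ 5 ∷ 10 ∷ []) 9)) p3 (found bare (8 ∷ 7 ∷ 3 ∷ 4 ∷ 6 ∷ 2 ∷ 5 ∷ 9 ∷ []) 8))) (ask 4 9 (ask 4 10 p3 p3 (found bare (6 ∷ 2 ∷ 5 ∷ 8 ∷ 7 ∷ 3 ∷ 4 ∷ 10 ∷ []) 9)) p3 (found bare (6 ∷ 2 ∷ 5 ∷ 8 ∷ 7 ∷ 3 ∷ 4 ∷ 9 ∷ []) 8)))))))) (ask 2 5 p3 (ask 2 6 p3 p3 (ask 3 4 p3 (ask 3 6 p3 p3 (ask 3 7 p3 p3 (ask 5 8 (ask 4 8 p3 p3 (ask 5 7 p3 p3 (ask 5 9 p3 p3 (found (marked front red) (8 ∷ 4 ∷ 2 ∷ 6 ∷ 3 ∷ 7 ∷ 5 ∷ 9 ∷ []) 8)))) p3 (ask 4 9 (ask 4 8 p3 p3 (ask 5 9 p3 p3 (found (marked back red) (7 ∷ 3 ∷ 6 ∷ 2 ∷ 4 ∷ 8 ∷ 5 ∷ 9 ∷ []) 8))) p3 (ask 5 7 (ask 5 9 p3 p3 (found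 (marked front red) (7 ∷ 3 ∷ 6 ∷ 2 ∷ 4 ∷ 9 ∷ 5 ∷ 8 ∷ []) 8)) p3 (found bare (8 ∷ 5 ∷ 7 ∷ 3 ∷ 6 ∷ 2 ∷ 4 ∷ 9 ∷ []) 8)))))) (ask 3 5 p3 p3 (ask 6 7 (ask 6 8 p3 (ask 5 7 p3 p3 (ask 6 9 p3 p3 (ask 7 8 p3 p3 (found (marked front blue) (8 ∷ 7 ∷ 5 ∷ 3 ∷ 4 ∷ 2 ∷ 6 ∷ 9 ∷ []) 8)))) (ask 8 7 p3 (ask 5 7 p3 p3 (ask 7 9 p3 p3 (found (marked front blue) (8 ∷ 6 ∷ 2 ∷ 4 ∷ 3 ∷ 5 ∷ 7 ∷ 9 ∷ []) 8))) (ask 5 9 (ask 5 10 p3 p3 (found (marked front red) (7 ∷ 8 ∷ 6 ∷ 2 ∷ 4 ∷ 3 ∷ 5 ∷ 10 ∷ []) 9)) p3 (found bare (7 ∷ 8 ∷ 6 ∷ 2 ∷ 4 ∷ 3 ∷ 5 ∷ 9 ∷ []) 8)))) (ask 6 8 (ask 5 8 p3 p3 (ask 6 9 p3 p3 (ask 7 8 p3 p3 (found (marked front blue) (7 ∷ 8 ∷ 5 ∷ 3 ∷ 4 ∷ 2 ∷ 6 ∷ 9 ∷ []) 8)))) p3 (ask 5 9 (ask 5 7 p3 p3 (ask 7 9 p3 p3 (found (marked back red) (8 ∷ 6 ∷ 2 ∷ 4 ∷ 3 ∷ 5 ∷ 7 ∷ 9 ∷ []) 8))) p3 (ask 7 8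 (ask 7 9 p3 p3 (found (marked front red) (7 ∷ 9 ∷ 5 ∷ 3 ∷ 4 ∷ 2 ∷ 6 ∷ 8 ∷ []) 8)) p3 (found bare (7 ∷ 8 ∷ 6 ∷ 2 ∷ 4 ∷ 3 ∷ 5 ∷ 9 ∷ []) 8)))) (ask 7 8 (ask 5 8 p3 p3 (ask 7 9 p3 (ask 7 10 p3 p3 (found (marked front red) (8 ∷ 5 ∷ 3 ∷ 4 ∷ 2 ∷ 6 ∷ 7 ∷ 10 ∷ []) 9)) (found bare (8 ∷ 5 ∷ 3 ∷ 4 ∷ 2 ∷ 6 ∷ 7 ∷ 9 ∷ []) 8))) (ask 5 8 (ask 5 9 p3 p3 (ask 9 8 p3 p3 (found (marked front blue) (7 ∷ 6 ∷ 2 ∷ 4 ∷ 3 ∷ 5 ∷ 9 ∷ 8 ∷ []) 8))) p3 (ask 7 9 (ask 7 10 p3 p3 (found (marked front blue) (8 ∷ 5 ∷ 3 ∷ 4 ∷ 2 ∷ 6 ∷ 7 ∷ 10 ∷ []) 9)) p3 (found bare (8 ∷ 5 ∷ 3 ∷ 4 ∷ 2 ∷ 6 ∷ 7 ∷ 9 ∷ []) 8))) (ask 5 9 (ask 5 10 p3 p3 (found bare (8 ∷ 7 ∷ 6 ∷ 2 ∷ 4 ∷ 3 ∷ 5 ∷ 10 ∷ []) 9)) p3 (found bare (8 ∷ 7 ∷ 6 ∷ 2 ∷ 4 ∷ 3 ∷ 5 ∷ 9 ∷ []) 8))))))) (ask 3 4 p3 (ask 3 5 p3 p3 (ask 3 6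 p3 p3 (ask 6 7 (ask 6 8 p3 (ask 4 7 p3 p3 (ask 6 9 p3 p3 (ask 7 8 p3 p3 (found (marked front blue) (8 ∷ 7 ∷ 4 ∷ 2 ∷ 5 ∷ 3 ∷ 6 ∷ 9 ∷ []) 8)))) (ask 8 7 p3 (ask 4 7 p3 p3 (ask 7 9 p3 p3 (found (marked front blue) (8 ∷ 6 ∷ 3 ∷ 5 ∷ 2 ∷ 4 ∷ 7 ∷ 9 ∷ []) 8))) (ask 4 9 (ask 4 10 p3 p3 (found (marked front red) (7 ∷ 8 ∷ 6 ∷ 3 ∷ 5 ∷ 2 ∷ 4 ∷ 10 ∷ []) 9)) p3 (found bare (7 ∷ 8 ∷ 6 ∷ 3 ∷ 5 ∷ 2 ∷ 4 ∷ 9 ∷ []) 8)))) (ask 6 8 (ask 4 8 p3 p3 (ask 6 9 p3 p3 (ask 7 8 p3 p3 (found (marked front blue) (7 ∷ 8 ∷ 4 ∷ 2 ∷ 5 ∷ 3 ∷ 6 ∷ 9 ∷ []) 8)))) p3 (ask 4 9 (ask 4 7 p3 p3 (ask 7 9 p3 p3 (found (marked back red) (8 ∷ 6 ∷ 3 ∷ 5 ∷ 2 ∷ 4 ∷ 7 ∷ 9 ∷ []) 8))) p3 (ask 7 8 (ask 7 9 p3 p3 (found (marked front red) (7 ∷ 9 ∷ 4 ∷ 2 ∷ 5 ∷ 3 ∷ 6 ∷ 8 ∷ []) 8)) p3 (found bare (7 ∷ 8 ∷ 6 ∷ 3 ∷ 5 ∷ 2 ∷ 4 ∷ 9 ∷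 []) 8)))) (ask 7 8 (ask 4 8 p3 p3 (ask 7 9 p3 (ask 7 10 p3 p3 (found (marked front red) (8 ∷ 4 ∷ 2 ∷ 5 ∷ 3 ∷ 6 ∷ 7 ∷ 10 ∷ []) 9)) (found bare (8 ∷ 4 ∷ 2 ∷ 5 ∷ 3 ∷ 6 ∷ 7 ∷ 9 ∷ []) 8))) (ask 4 8 (ask 4 9 p3 p3 (ask 9 8 p3 p3 (found (marked front blue) (7 ∷ 6 ∷ 3 ∷ 5 ∷ 2 ∷ 4 ∷ 9 ∷ 8 ∷ []) 8))) p3 (ask 7 9 (ask 7 10 p3 p3 (found (marked front blue) (8 ∷ 4 ∷ 2 ∷ 5 ∷ 3 ∷ 6 ∷ 7 ∷ 10 ∷ []) 9)) p3 (found bare (8 ∷ 4 ∷ 2 ∷ 5 ∷ 3 ∷ 6 ∷ 7 ∷ 9 ∷ []) 8))) (ask 4 9 (ask 4 10 p3 p3 (found bare (8 ∷ 7 ∷ 6 ∷ 3 ∷ 5 ∷ 2 ∷ 4 ∷ 10 ∷ []) 9)) p3 (found bare (8 ∷ 7 ∷ 6 ∷ 3 ∷ 5 ∷ 2 ∷ 4 ∷ 9 ∷ []) 8)))))) (ask 3 6 p3 (ask 3 7 p3 p3 (ask 5 6 (ask 5 8 p3 (ask 5 9 p3 p3 (ask 6 7 p3 p3 (ask 6 8 p3 p3 (found (marked front blue) (8 ∷ 6 ∷ 7 ∷ 3 ∷ 4 ∷ 2 ∷ 5 ∷ 9 ∷ []) 8)))) (ask 6 7 p3 p3 (ask 6 9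 p3 p3 (found bare (8 ∷ 5 ∷ 2 ∷ 4 ∷ 3 ∷ 7 ∷ 6 ∷ 9 ∷ []) 8)))) p3 (ask 7 8 (ask 6 8 p3 p3 (ask 7 9 p3 (ask 7 10 p3 p3 (found (marked front red) (8 ∷ 6 ∷ 5 ∷ 2 ∷ 4 ∷ 3 ∷ 7 ∷ 10 ∷ []) 9)) (found bare (8 ∷ 6 ∷ 5 ∷ 2 ∷ 4 ∷ 3 ∷ 7 ∷ 9 ∷ []) 8))) (ask 6 8 (ask 6 9 p3 p3 (ask 9 8 p3 p3 (found (marked front blue) (7 ∷ 3 ∷ 4 ∷ 2 ∷ 5 ∷ 6 ∷ 9 ∷ 8 ∷ []) 8))) p3 (ask 7 9 (ask 7 10 p3 p3 (found (marked front blue) (8 ∷ 6 ∷ 5 ∷ 2 ∷ 4 ∷ 3 ∷ 7 ∷ 10 ∷ []) 9)) p3 (found bare (8 ∷ 6 ∷ 5 ∷ 2 ∷ 4 ∷ 3 ∷ 7 ∷ 9 ∷ []) 8))) (ask 6 9 (ask 6 10 p3 p3 (found bare (8 ∷ 7 ∷ 3 ∷ 4 ∷ 2 ∷ 5 ∷ 6 ∷ 10 ∷ []) 9)) p3 (found bare (8 ∷ 7 ∷ 3 ∷ 4 ∷ 2 ∷ 5 ∷ 6 ∷ 9 ∷ []) 8))))) (ask 5 7 (ask 5 8 p3 (ask 5 9 p3 p3 (ask 6 7 p3 (ask 9 7 p3 p3 (ask 7 8 p3 p3 (found (marked front blue) (6 ∷ 3 ∷ 4 ∷ 2 ∷ 5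 ∷ 9 ∷ 7 ∷ 8 ∷ []) 8))) (ask 7 8 p3 p3 (found bare (8 ∷ 7 ∷ 6 ∷ 3 ∷ 4 ∷ 2 ∷ 5 ∷ 9 ∷ []) 8)))) (ask 6 7 p3 (ask 6 9 (ask 6 10 p3 p3 (ask 7 8 p3 p3 (found (marked front red) (7 ∷ 8 ∷ 5 ∷ 2 ∷ 4 ∷ 3 ∷ 6 ∷ 10 ∷ []) 9))) p3 (ask 7 8 p3 p3 (found bare (7 ∷ 8 ∷ 5 ∷ 2 ∷ 4 ∷ 3 ∷ 6 ∷ 9 ∷ []) 8))) (ask 7 9 p3 (ask 7 10 p3 p3 (found bare (8 ∷ 5 ∷ 2 ∷ 4 ∷ 3 ∷ 6 ∷ 7 ∷ 10 ∷ []) 9)) (found bare (8 ∷ 5 ∷ 2 ∷ 4 ∷ 3 ∷ 6 ∷ 7 ∷ 9 ∷ []) 8)))) (ask 5 8 (ask 5 9 p3 p3 (ask 6 7 (ask 9 7 p3 p3 (ask 7 8 p3 p3 (found (marked front red) (6 ∷ 3 ∷ 4 ∷ 2 ∷ 5 ∷ 9 ∷ 7 ∷ 8 ∷ []) 8))) p3 (ask 7 8 p3 p3 (found bare (8 ∷ 7 ∷ 6 ∷ 3 ∷ 4 ∷ 2 ∷ 5 ∷ 9 ∷ []) 8)))) p3 (ask 6 7 (ask 6 9 p3 (ask 6 10 p3 p3 (ask 7 8 p3 p3 (found (marked front red) (7 ∷ 8 ∷ 5 ∷ 2 ∷ 4 ∷ 3 ∷ 6 ∷ 10 ∷ []) 9)))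 (ask 7 8 p3 p3 (found bare (7 ∷ 8 ∷ 5 ∷ 2 ∷ 4 ∷ 3 ∷ 6 ∷ 9 ∷ []) 8))) p3 (ask 7 9 (ask 7 10 p3 p3 (found bare (8 ∷ 5 ∷ 2 ∷ 4 ∷ 3 ∷ 6 ∷ 7 ∷ 10 ∷ []) 9)) p3 (found bare (8 ∷ 5 ∷ 2 ∷ 4 ∷ 3 ∷ 6 ∷ 7 ∷ 9 ∷ []) 8)))) (ask 6 8 (ask 6 9 p3 (ask 6 10 p3 p3 (ask 7 8 p3 (ask 10 8 p3 p3 (found (marked front blue) (7 ∷ 5 ∷ 2 ∷ 4 ∷ 3 ∷ 6 ∷ 10 ∷ 8 ∷ []) 9)) (found bare (8 ∷ 7 ∷ 5 ∷ 2 ∷ 4 ∷ 3 ∷ 6 ∷ 10 ∷ []) 9))) (ask 7 8 p3 (ask 7 10 (ask 9 8 p3 p3 (found (marked front red) (7 ∷ 5 ∷ 2 ∷ 4 ∷ 3 ∷ 6 ∷ 9 ∷ 8 ∷ []) 9)) p3 (found bare (9 ∷ 6 ∷ 3 ∷ 4 ∷ 2 ∷ 5 ∷ 7 ∷ 10 ∷ []) 9)) (found bare (8 ∷ 7 ∷ 5 ∷ 2 ∷ 4 ∷ 3 ∷ 6 ∷ 9 ∷ []) 8))) (ask 6 9 (ask 6 10 p3 p3 (ask 7 8 (ask 10 8 p3 p3 (found (marked front red) (7 ∷ 5 ∷ 2 ∷ 4 ∷ 3 ∷ 6 ∷ 10 ∷ 8 ∷ []) 9)) p3 (found bare (8 ∷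 7 ∷ 5 ∷ 2 ∷ 4 ∷ 3 ∷ 6 ∷ 10 ∷ []) 9))) p3 (ask 7 8 (ask 7 10 p3 (ask 9 8 p3 p3 (found (marked front red) (7 ∷ 5 ∷ 2 ∷ 4 ∷ 3 ∷ 6 ∷ 9 ∷ 8 ∷ []) 9)) (found bare (9 ∷ 6 ∷ 3 ∷ 4 ∷ 2 ∷ 5 ∷ 7 ∷ 10 ∷ []) 9)) p3 (found bare (8 ∷ 7 ∷ 5 ∷ 2 ∷ 4 ∷ 3 ∷ 6 ∷ 9 ∷ []) 8))) (ask 7 9 (ask 7 10 p3 (ask 7 11 p3 p3 (found bare (8 ∷ 6 ∷ 3 ∷ 4 ∷ 2 ∷ 5 ∷ 7 ∷ 11 ∷ []) 10)) (found bare (8 ∷ 6 ∷ 3 ∷ 4 ∷ 2 ∷ 5 ∷ 7 ∷ 10 ∷ []) 9)) (ask 7 10 (ask 7 11 p3 p3 (found bare (8 ∷ 6 ∷ 3 ∷ 4 ∷ 2 ∷ 5 ∷ 7 ∷ 11 ∷ []) 10)) p3 (found bare (8 ∷ 6 ∷ 3 ∷ 4 ∷ 2 ∷ 5 ∷ 7 ∷ 10 ∷ []) 9)) (found bare (8 ∷ 6 ∷ 3 ∷ 4 ∷ 2 ∷ 5 ∷ 7 ∷ 9 ∷ []) 8)))))))) (ask 2 4 (ask 2 5 p3 p3 (ask 2 6 p3 p3 (ask 3 4 p3 p3 (ask 3 7 (ask 3 5 p3 p3 (ask 7 8 p3 (ask 4 8 p3 p3 (ask 6 7 p3 p3 (ask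 7 9 p3 p3 (found (marked front blue) (8 ∷ 4 ∷ 3 ∷ 5 ∷ 2 ∷ 6 ∷ 7 ∷ 9 ∷ []) 8)))) (ask 4 9 p3 (ask 4 8 p3 p3 (ask 7 9 p3 p3 (found (marked back blue) (6 ∷ 2 ∷ 5 ∷ 3 ∷ 4 ∷ 8 ∷ 7 ∷ 9 ∷ []) 8))) (ask 6 7 p3 (ask 9 7 p3 p3 (found (marked front blue) (6 ∷ 2 ∷ 5 ∷ 3 ∷ 4 ∷ 9 ∷ 7 ∷ 8 ∷ []) 8)) (found bare (8 ∷ 7 ∷ 6 ∷ 2 ∷ 5 ∷ 3 ∷ 4 ∷ 9 ∷ []) 8))))) p3 (ask 7 8 (ask 4 8 p3 (ask 4 5 p3 p3 (ask 6 8 p3 p3 (ask 8 9 p3 p3 (found (marked front red) (7 ∷ 3 ∷ 4 ∷ 5 ∷ 2 ∷ 6 ∷ 8 ∷ 9 ∷ []) 8)))) (ask 7 9 p3 (ask 5 7 p3 p3 (ask 8 9 p3 p3 (found (marked back blue) (6 ∷ 2 ∷ 5 ∷ 7 ∷ 3 ∷ 4 ∷ 8 ∷ 9 ∷ []) 8))) (ask 5 8 p3 (ask 6 8 p3 p3 (found (marked front blue) (5 ∷ 2 ∷ 6 ∷ 8 ∷ 4 ∷ 3 ∷ 7 ∷ 9 ∷ []) 8)) (found bare (6 ∷ 2 ∷ 5 ∷ 8 ∷ 4 ∷ 3 ∷ 7 ∷ 9 ∷ []) 8)))) (ask 4 8 p3 p3 (ask 7 9 (ask 5 7 p3 p3 (ask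 8 9 p3 p3 (found (marked back red) (6 ∷ 2 ∷ 5 ∷ 7 ∷ 3 ∷ 4 ∷ 8 ∷ 9 ∷ []) 8))) p3 (ask 5 8 (ask 6 8 p3 p3 (found (marked front red) (5 ∷ 2 ∷ 6 ∷ 8 ∷ 4 ∷ 3 ∷ 7 ∷ 9 ∷ []) 8)) p3 (found bare (6 ∷ 2 ∷ 5 ∷ 8 ∷ 4 ∷ 3 ∷ 7 ∷ 9 ∷ []) 8)))) (ask 8 5 (ask 4 6 p3 (ask 4 9 p3 p3 (ask 6 8 p3 p3 (found (marked front red) (5 ∷ 2 ∷ 6 ∷ 8 ∷ 7 ∷ 3 ∷ 4 ∷ 9 ∷ []) 8))) (ask 5 9 p3 (ask 5 10 p3 p3 (found (marked front red) (8 ∷ 7 ∷ 3 ∷ 4 ∷ 6 ∷ 2 ∷ 5 ∷ 10 ∷ []) 9)) (found bare (8 ∷ 7 ∷ 3 ∷ 4 ∷ 6 ∷ 2 ∷ 5 ∷ 9 ∷ []) 8))) (ask 8 6 (ask 4 5 p3 p3 (ask 8 9 p3 p3 (found (marked front red) (6 ∷ 2 ∷ 5 ∷ 4 ∷ 3 ∷ 7 ∷ 8 ∷ 9 ∷ []) 8))) p3 (ask 4 9 p3 (ask 4 10 p3 p3 (found (marked front blue) (5 ∷ 2 ∷ 6 ∷ 8 ∷ 7 ∷ 3 ∷ 4 ∷ 10 ∷ []) 9)) (found bare (5 ∷ 2 ∷ 6 ∷ 8 ∷ 7 ∷ 3 ∷ 4 ∷ 9 ∷ []) 8))) (ask 4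 9 p3 (ask 4 10 p3 p3 (found bare (6 ∷ 2 ∷ 5 ∷ 8 ∷ 7 ∷ 3 ∷ 4 ∷ 10 ∷ []) 9)) (found bare (6 ∷ 2 ∷ 5 ∷ 8 ∷ 7 ∷ 3 ∷ 4 ∷ 9 ∷ []) 8)))))))) p3 (ask 2 5 (ask 2 6 p3 p3 (ask 3 4 (ask 3 6 p3 p3 (ask 3 7 p3 p3 (ask 5 8 p3 (ask 4 8 p3 p3 (ask 5 7 p3 p3 (ask 5 9 p3 p3 (found (marked front blue) (8 ∷ 4 ∷ 2 ∷ 6 ∷ 3 ∷ 7 ∷ 5 ∷ 9 ∷ []) 8)))) (ask 4 9 p3 (ask 4 8 p3 p3 (ask 5 9 p3 p3 (found (marked back blue) (7 ∷ 3 ∷ 6 ∷ 2 ∷ 4 ∷ 8 ∷ 5 ∷ 9 ∷ []) 8))) (ask 5 7 p3 (ask 5 9 p3 p3 (found (marked front blue) (7 ∷ 3 ∷ 6 ∷ 2 ∷ 4 ∷ 9 ∷ 5 ∷ 8 ∷ []) 8)) (found bare (8 ∷ 5 ∷ 7 ∷ 3 ∷ 6 ∷ 2 ∷ 4 ∷ 9 ∷ []) 8)))))) p3 (ask 3 5 p3 p3 (ask 6 7 (ask 6 8 p3 (ask 5 8 p3 p3 (ask 6 9 p3 p3 (ask 7 8 p3 p3 (found (marked front red) (7 ∷ 8 ∷ 5 ∷ 3 ∷ 4 ∷ 2 ∷ 6 ∷ 9 ∷ []) 8)))) (ask 5 9 p3 (ask 5 7 p3 p3 (ask 7 9 p3 p3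 (found (marked back blue) (8 ∷ 6 ∷ 2 ∷ 4 ∷ 3 ∷ 5 ∷ 7 ∷ 9 ∷ []) 8))) (ask 7 8 p3 (ask 7 9 p3 p3 (found (marked front red) (7 ∷ 9 ∷ 5 ∷ 3 ∷ 4 ∷ 2 ∷ 6 ∷ 8 ∷ []) 8)) (found bare (7 ∷ 8 ∷ 6 ∷ 2 ∷ 4 ∷ 3 ∷ 5 ∷ 9 ∷ []) 8)))) (ask 6 8 (ask 5 7 p3 p3 (ask 6 9 p3 p3 (ask 7 8 p3 p3 (found (marked front red) (8 ∷ 7 ∷ 5 ∷ 3 ∷ 4 ∷ 2 ∷ 6 ∷ 9 ∷ []) 8)))) p3 (ask 8 7 (ask 5 7 p3 p3 (ask 7 9 p3 p3 (found (marked front red) (8 ∷ 6 ∷ 2 ∷ 4 ∷ 3 ∷ 5 ∷ 7 ∷ 9 ∷ []) 8))) p3 (ask 5 9 p3 (ask 5 10 p3 p3 (found (marked front blue) (7 ∷ 8 ∷ 6 ∷ 2 ∷ 4 ∷ 3 ∷ 5 ∷ 10 ∷ []) 9)) (found bare (7 ∷ 8 ∷ 6 ∷ 2 ∷ 4 ∷ 3 ∷ 5 ∷ 9 ∷ []) 8)))) (ask 7 8 (ask 5 8 p3 (ask 5 9 p3 p3 (ask 9 8 p3 p3 (found (marked front red) (7 ∷ 6 ∷ 2 ∷ 4 ∷ 3 ∷ 5 ∷ 9 ∷ 8 ∷ []) 8))) (ask 7 9 p3 (ask 7 10 p3 p3 (found (marked front red) (8 ∷ 5 ∷ 3 ∷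 4 ∷ 2 ∷ 6 ∷ 7 ∷ 10 ∷ []) 9)) (found bare (8 ∷ 5 ∷ 3 ∷ 4 ∷ 2 ∷ 6 ∷ 7 ∷ 9 ∷ []) 8))) (ask 5 8 p3 p3 (ask 7 9 (ask 7 10 p3 p3 (found (marked front blue) (8 ∷ 5 ∷ 3 ∷ 4 ∷ 2 ∷ 6 ∷ 7 ∷ 10 ∷ []) 9)) p3 (found bare (8 ∷ 5 ∷ 3 ∷ 4 ∷ 2 ∷ 6 ∷ 7 ∷ 9 ∷ []) 8))) (ask 5 9 p3 (ask 5 10 p3 p3 (found bare (8 ∷ 7 ∷ 6 ∷ 2 ∷ 4 ∷ 3 ∷ 5 ∷ 10 ∷ []) 9)) (found bare (8 ∷ 7 ∷ 6 ∷ 2 ∷ 4 ∷ 3 ∷ 5 ∷ 9 ∷ []) 8))))))) p3 (ask 3 4 (ask 3 5 p3 p3 (ask 3 6 p3 p3 (ask 6 7 (ask 6 8 p3 (ask 4 8 p3 p3 (ask 6 9 p3 p3 (ask 7 8 p3 p3 (found (marked front red) (7 ∷ 8 ∷ 4 ∷ 2 ∷ 5 ∷ 3 ∷ 6 ∷ 9 ∷ []) 8)))) (ask 4 9 p3 (ask 4 7 p3 p3 (ask 7 9 p3 p3 (found (marked back blue) (8 ∷ 6 ∷ 3 ∷ 5 ∷ 2 ∷ 4 ∷ 7 ∷ 9 ∷ []) 8))) (ask 7 8 p3 (ask 7 9 p3 p3 (found (marked front red) (7 ∷ 9 ∷ 4 ∷ 2 ∷ 5 ∷ 3 ∷ 6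 ∷ 8 ∷ []) 8)) (found bare (7 ∷ 8 ∷ 6 ∷ 3 ∷ 5 ∷ 2 ∷ 4 ∷ 9 ∷ []) 8)))) (ask 6 8 (ask 4 7 p3 p3 (ask 6 9 p3 p3 (ask 7 8 p3 p3 (found (marked front red) (8 ∷ 7 ∷ 4 ∷ 2 ∷ 5 ∷ 3 ∷ 6 ∷ 9 ∷ []) 8)))) p3 (ask 8 7 (ask 4 7 p3 p3 (ask 7 9 p3 p3 (found (marked front red) (8 ∷ 6 ∷ 3 ∷ 5 ∷ 2 ∷ 4 ∷ 7 ∷ 9 ∷ []) 8))) p3 (ask 4 9 p3 (ask 4 10 p3 p3 (found (marked front blue) (7 ∷ 8 ∷ 6 ∷ 3 ∷ 5 ∷ 2 ∷ 4 ∷ 10 ∷ []) 9)) (found bare (7 ∷ 8 ∷ 6 ∷ 3 ∷ 5 ∷ 2 ∷ 4 ∷ 9 ∷ []) 8)))) (ask 7 8 (ask 4 8 p3 (ask 4 9 p3 p3 (ask 9 8 p3 p3 (found (marked front red) (7 ∷ 6 ∷ 3 ∷ 5 ∷ 2 ∷ 4 ∷ 9 ∷ 8 ∷ []) 8))) (ask 7 9 p3 (ask 7 10 p3 p3 (found (marked front red) (8 ∷ 4 ∷ 2 ∷ 5 ∷ 3 ∷ 6 ∷ 7 ∷ 10 ∷ []) 9)) (found bare (8 ∷ 4 ∷ 2 ∷ 5 ∷ 3 ∷ 6 ∷ 7 ∷ 9 ∷ []) 8))) (ask 4 8 p3 p3 (ask 7 9 (ask 7 10 p3 p3 (found (marked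 front blue) (8 ∷ 4 ∷ 2 ∷ 5 ∷ 3 ∷ 6 ∷ 7 ∷ 10 ∷ []) 9)) p3 (found bare (8 ∷ 4 ∷ 2 ∷ 5 ∷ 3 ∷ 6 ∷ 7 ∷ 9 ∷ []) 8))) (ask 4 9 p3 (ask 4 10 p3 p3 (found bare (8 ∷ 7 ∷ 6 ∷ 3 ∷ 5 ∷ 2 ∷ 4 ∷ 10 ∷ []) 9)) (found bare (8 ∷ 7 ∷ 6 ∷ 3 ∷ 5 ∷ 2 ∷ 4 ∷ 9 ∷ []) 8)))))) p3 (ask 3 6 (ask 3 7 p3 p3 (ask 5 6 p3 (ask 5 8 (ask 5 9 p3 p3 (ask 6 7 p3 p3 (ask 6 8 p3 p3 (found (marked front red) (8 ∷ 6 ∷ 7 ∷ 3 ∷ 4 ∷ 2 ∷ 5 ∷ 9 ∷ []) 8)))) p3 (ask 6 7 p3 p3 (ask 6 9 p3 p3 (found bare (8 ∷ 5 ∷ 2 ∷ 4 ∷ 3 ∷ 7 ∷ 6 ∷ 9 ∷ []) 8)))) (ask 7 8 (ask 6 8 p3 (ask 6 9 p3 p3 (ask 9 8 p3 p3 (found (marked front red) (7 ∷ 3 ∷ 4 ∷ 2 ∷ 5 ∷ 6 ∷ 9 ∷ 8 ∷ []) 8))) (ask 7 9 p3 (ask 7 10 p3 p3 (found (marked front red) (8 ∷ 6 ∷ 5 ∷ 2 ∷ 4 ∷ 3 ∷ 7 ∷ 10 ∷ []) 9)) (found bare (8 ∷ 6 ∷ 5 ∷ 2 ∷ 4 ∷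 3 ∷ 7 ∷ 9 ∷ []) 8))) (ask 6 8 p3 p3 (ask 7 9 (ask 7 10 p3 p3 (found (marked front blue) (8 ∷ 6 ∷ 5 ∷ 2 ∷ 4 ∷ 3 ∷ 7 ∷ 10 ∷ []) 9)) p3 (found bare (8 ∷ 6 ∷ 5 ∷ 2 ∷ 4 ∷ 3 ∷ 7 ∷ 9 ∷ []) 8))) (ask 6 9 p3 (ask 6 10 p3 p3 (found bare (8 ∷ 7 ∷ 3 ∷ 4 ∷ 2 ∷ 5 ∷ 6 ∷ 10 ∷ []) 9)) (found bare (8 ∷ 7 ∷ 3 ∷ 4 ∷ 2 ∷ 5 ∷ 6 ∷ 9 ∷ []) 8))))) p3 (ask 5 7 (ask 5 8 p3 (ask 5 9 p3 p3 (ask 6 7 p3 (ask 9 7 p3 p3 (ask 7 8 p3 p3 (found (marked front blue) (6 ∷ 3 ∷ 4 ∷ 2 ∷ 5 ∷ 9 ∷ 7 ∷ 8 ∷ []) 8))) (ask 7 8 p3 p3 (found bare (8 ∷ 7 ∷ 6 ∷ 3 ∷ 4 ∷ 2 ∷ 5 ∷ 9 ∷ []) 8)))) (ask 6 7 p3 (ask 6 9 (ask 6 10 p3 p3 (ask 7 8 p3 p3 (found (marked front red) (7 ∷ 8 ∷ 5 ∷ 2 ∷ 4 ∷ 3 ∷ 6 ∷ 10 ∷ []) 9))) p3 (ask 7 8 p3 p3 (found bare (7 ∷ 8 ∷ 5 ∷ 2 ∷ 4 ∷ 3 ∷ 6 ∷ 9 ∷ []) 8))) (ask 7 9 p3 (ask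 7 10 p3 p3 (found bare (8 ∷ 5 ∷ 2 ∷ 4 ∷ 3 ∷ 6 ∷ 7 ∷ 10 ∷ []) 9)) (found bare (8 ∷ 5 ∷ 2 ∷ 4 ∷ 3 ∷ 6 ∷ 7 ∷ 9 ∷ []) 8)))) (ask 5 8 (ask 5 9 p3 p3 (ask 6 7 (ask 9 7 p3 p3 (ask 7 8 p3 p3 (found (marked front red) (6 ∷ 3 ∷ 4 ∷ 2 ∷ 5 ∷ 9 ∷ 7 ∷ 8 ∷ []) 8))) p3 (ask 7 8 p3 p3 (found bare (8 ∷ 7 ∷ 6 ∷ 3 ∷ 4 ∷ 2 ∷ 5 ∷ 9 ∷ []) 8)))) p3 (ask 6 7 (ask 6 9 p3 (ask 6 10 p3 p3 (ask 7 8 p3 p3 (found (marked front red) (7 ∷ 8 ∷ 5 ∷ 2 ∷ 4 ∷ 3 ∷ 6 ∷ 10 ∷ []) 9))) (ask 7 8 p3 p3 (found bare (7 ∷ 8 ∷ 5 ∷ 2 ∷ 4 ∷ 3 ∷ 6 ∷ 9 ∷ []) 8))) p3 (ask 7 9 (ask 7 10 p3 p3 (found bare (8 ∷ 5 ∷ 2 ∷ 4 ∷ 3 ∷ 6 ∷ 7 ∷ 10 ∷ []) 9)) p3 (found bare (8 ∷ 5 ∷ 2 ∷ 4 ∷ 3 ∷ 6 ∷ 7 ∷ 9 ∷ []) 8)))) (ask 6 8 (ask 6 9 p3 (ask 6 10 p3 p3 (ask 7 8 p3 (ask 10 8 p3 p3 (found (marked front blue) (7 ∷ 5 ∷ 2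 ∷ 4 ∷ 3 ∷ 6 ∷ 10 ∷ 8 ∷ []) 9)) (found bare (8 ∷ 7 ∷ 5 ∷ 2 ∷ 4 ∷ 3 ∷ 6 ∷ 10 ∷ []) 9))) (ask 7 8 p3 (ask 7 10 (ask 9 8 p3 p3 (found (marked front red) (7 ∷ 5 ∷ 2 ∷ 4 ∷ 3 ∷ 6 ∷ 9 ∷ 8 ∷ []) 9)) p3 (found bare (9 ∷ 6 ∷ 3 ∷ 4 ∷ 2 ∷ 5 ∷ 7 ∷ 10 ∷ []) 9)) (found bare (8 ∷ 7 ∷ 5 ∷ 2 ∷ 4 ∷ 3 ∷ 6 ∷ 9 ∷ []) 8))) (ask 6 9 (ask 6 10 p3 p3 (ask 7 8 (ask 10 8 p3 p3 (found (marked front red) (7 ∷ 5 ∷ 2 ∷ 4 ∷ 3 ∷ 6 ∷ 10 ∷ 8 ∷ []) 9)) p3 (found bare (8 ∷ 7 ∷ 5 ∷ 2 ∷ 4 ∷ 3 ∷ 6 ∷ 10 ∷ []) 9))) p3 (ask 7 8 (ask 7 10 p3 (ask 9 8 p3 p3 (found (marked front red) (7 ∷ 5 ∷ 2 ∷ 4 ∷ 3 ∷ 6 ∷ 9 ∷ 8 ∷ []) 9)) (found bare (9 ∷ 6 ∷ 3 ∷ 4 ∷ 2 ∷ 5 ∷ 7 ∷ 10 ∷ []) 9)) p3 (found bare (8 ∷ 7 ∷ 5 ∷ 2 ∷ 4 ∷ 3 ∷ 6 ∷ 9 ∷ []) 8))) (ask 7 9 (ask 7 10 p3 (ask 7 11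 p3 p3 (found bare (8 ∷ 6 ∷ 3 ∷ 4 ∷ 2 ∷ 5 ∷ 7 ∷ 11 ∷ []) 10)) (found bare (8 ∷ 6 ∷ 3 ∷ 4 ∷ 2 ∷ 5 ∷ 7 ∷ 10 ∷ []) 9)) (ask 7 10 (ask 7 11 p3 p3 (found bare (8 ∷ 6 ∷ 3 ∷ 4 ∷ 2 ∷ 5 ∷ 7 ∷ 11 ∷ []) 10)) p3 (found bare (8 ∷ 6 ∷ 3 ∷ 4 ∷ 2 ∷ 5 ∷ 7 ∷ 10 ∷ []) 9)) (found bare (8 ∷ 6 ∷ 3 ∷ 4 ∷ 2 ∷ 5 ∷ 7 ∷ 9 ∷ []) 8)))))))) (ask 2 4 (ask 2 5 p3 (ask 2 6 p3 p3 (ask 3 4 p3 (ask 6 4 p3 p3 (ask 4 7 p3 p3 (ask 5 8 (ask 3 8 p3 p3 (ask 5 7 p3 p3 (ask 5 9 p3 p3 (found (marked front red) (8 ∷ 3 ∷ 2 ∷ 6 ∷ 4 ∷ 7 ∷ 5 ∷ 9 ∷ []) 8)))) p3 (ask 3 9 (ask 3 8 p3 p3 (ask 5 9 p3 p3 (found (marked back red) (7 ∷ 4 ∷ 6 ∷ 2 ∷ 3 ∷ 8 ∷ 5 ∷ 9 ∷ []) 8))) p3 (ask 5 7 (ask 5 9 p3 p3 (found (marked front red) (7 ∷ 4 ∷ 6 ∷ 2 ∷ 3 ∷ 9 ∷ 5 ∷ 8 ∷ []) 8)) p3 (found bare (8 ∷ 5 ∷ 7 ∷ 4 ∷ 6 ∷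 2 ∷ 3 ∷ 9 ∷ []) 8)))))) (ask 4 5 p3 p3 (ask 6 7 (ask 6 8 p3 (ask 5 7 p3 p3 (ask 6 9 p3 p3 (ask 7 8 p3 p3 (found (marked front blue) (8 ∷ 7 ∷ 5 ∷ 4 ∷ 3 ∷ 2 ∷ 6 ∷ 9 ∷ []) 8)))) (ask 8 7 p3 (ask 5 7 p3 p3 (ask 7 9 p3 p3 (found (marked front blue) (8 ∷ 6 ∷ 2 ∷ 3 ∷ 4 ∷ 5 ∷ 7 ∷ 9 ∷ []) 8))) (ask 5 9 (ask 5 10 p3 p3 (found (marked front red) (7 ∷ 8 ∷ 6 ∷ 2 ∷ 3 ∷ 4 ∷ 5 ∷ 10 ∷ []) 9)) p3 (found bare (7 ∷ 8 ∷ 6 ∷ 2 ∷ 3 ∷ 4 ∷ 5 ∷ 9 ∷ []) 8)))) (ask 6 8 (ask 5 8 p3 p3 (ask 6 9 p3 p3 (ask 7 8 p3 p3 (found (marked front blue) (7 ∷ 8 ∷ 5 ∷ 4 ∷ 3 ∷ 2 ∷ 6 ∷ 9 ∷ []) 8)))) p3 (ask 5 9 (ask 5 7 p3 p3 (ask 7 9 p3 p3 (found (marked back red) (8 ∷ 6 ∷ 2 ∷ 3 ∷ 4 ∷ 5 ∷ 7 ∷ 9 ∷ []) 8))) p3 (ask 7 8 (ask 7 9 p3 p3 (found (marked front red) (7 ∷ 9 ∷ 5 ∷ 4 ∷ 3 ∷ 2 ∷ 6 ∷ 8 ∷ []) 8)) p3 (found bare (7 ∷ 8 ∷ 6 ∷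 2 ∷ 3 ∷ 4 ∷ 5 ∷ 9 ∷ []) 8)))) (ask 7 8 (ask 5 8 p3 p3 (ask 7 9 p3 (ask 7 10 p3 p3 (found (marked front red) (8 ∷ 5 ∷ 4 ∷ 3 ∷ 2 ∷ 6 ∷ 7 ∷ 10 ∷ []) 9)) (found bare (8 ∷ 5 ∷ 4 ∷ 3 ∷ 2 ∷ 6 ∷ 7 ∷ 9 ∷ []) 8))) (ask 5 8 (ask 5 9 p3 p3 (ask 9 8 p3 p3 (found (marked front blue) (7 ∷ 6 ∷ 2 ∷ 3 ∷ 4 ∷ 5 ∷ 9 ∷ 8 ∷ []) 8))) p3 (ask 7 9 (ask 7 10 p3 p3 (found (marked front blue) (8 ∷ 5 ∷ 4 ∷ 3 ∷ 2 ∷ 6 ∷ 7 ∷ 10 ∷ []) 9)) p3 (found bare (8 ∷ 5 ∷ 4 ∷ 3 ∷ 2 ∷ 6 ∷ 7 ∷ 9 ∷ []) 8))) (ask 5 9 (ask 5 10 p3 p3 (found bare (8 ∷ 7 ∷ 6 ∷ 2 ∷ 3 ∷ 4 ∷ 5 ∷ 10 ∷ []) 9)) p3 (found bare (8 ∷ 7 ∷ 6 ∷ 2 ∷ 3 ∷ 4 ∷ 5 ∷ 9 ∷ []) 8))))))) (ask 3 4 p3 (ask 3 6 (ask 3 7 p3 p3 (ask 4 5 p3 p3 (ask 7 6 p3 (ask 4 8 p3 p3 (ask 6 8 p3 p3 (ask 6 9 p3 p3 (found (marked front blue) (7 ∷ 3 ∷ 2 ∷ 5 ∷ 4 ∷ 8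 ∷ 6 ∷ 9 ∷ []) 8)))) (ask 6 8 p3 (ask 4 8 p3 p3 (ask 6 9 p3 p3 (found (marked front blue) (8 ∷ 4 ∷ 5 ∷ 2 ∷ 3 ∷ 7 ∷ 6 ∷ 9 ∷ []) 8))) (ask 4 9 p3 p3 (found bare (8 ∷ 6 ∷ 7 ∷ 3 ∷ 2 ∷ 5 ∷ 4 ∷ 9 ∷ []) 8)))))) p3 (ask 4 5 p3 p3 (ask 6 7 (ask 6 8 p3 (ask 4 7 p3 p3 (ask 6 9 p3 p3 (ask 7 8 p3 p3 (found (marked front blue) (8 ∷ 7 ∷ 4 ∷ 5 ∷ 2 ∷ 3 ∷ 6 ∷ 9 ∷ []) 8)))) (ask 4 9 p3 p3 (ask 7 8 p3 (ask 7 9 p3 p3 (found (marked front red) (7 ∷ 9 ∷ 4 ∷ 5 ∷ 2 ∷ 3 ∷ 6 ∷ 8 ∷ []) 8)) (found bare (7 ∷ 8 ∷ 6 ∷ 3 ∷ 2 ∷ 5 ∷ 4 ∷ 9 ∷ []) 8)))) (ask 6 8 (ask 4 7 p3 p3 (ask 6 9 p3 p3 (ask 7 8 p3 p3 (found (marked front red) (8 ∷ 7 ∷ 4 ∷ 5 ∷ 2 ∷ 3 ∷ 6 ∷ 9 ∷ []) 8)))) p3 (ask 4 9 p3 p3 (ask 7 8 (ask 7 9 p3 p3 (found (marked front red) (7 ∷ 9 ∷ 4 ∷ 5 ∷ 2 ∷ 3 ∷ 6 ∷ 8 ∷ []) 8)) p3 (found bare (7 ∷ 8 ∷ 6 ∷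 3 ∷ 2 ∷ 5 ∷ 4 ∷ 9 ∷ []) 8)))) (ask 7 8 (ask 4 8 p3 p3 (ask 7 9 p3 (ask 7 10 p3 p3 (found (marked front red) (8 ∷ 4 ∷ 5 ∷ 2 ∷ 3 ∷ 6 ∷ 7 ∷ 10 ∷ []) 9)) (found bare (8 ∷ 4 ∷ 5 ∷ 2 ∷ 3 ∷ 6 ∷ 7 ∷ 9 ∷ []) 8))) (ask 4 8 p3 p3 (ask 7 9 (ask 7 10 p3 p3 (found (marked front blue) (8 ∷ 4 ∷ 5 ∷ 2 ∷ 3 ∷ 6 ∷ 7 ∷ 10 ∷ []) 9)) p3 (found bare (8 ∷ 4 ∷ 5 ∷ 2 ∷ 3 ∷ 6 ∷ 7 ∷ 9 ∷ []) 8))) (ask 4 9 p3 p3 (found bare (8 ∷ 7 ∷ 6 ∷ 3 ∷ 2 ∷ 5 ∷ 4 ∷ 9 ∷ []) 8)))))) (ask 4 6 p3 (ask 4 7 p3 p3 (ask 5 6 (ask 5 8 p3 (ask 5 9 p3 p3 (ask 6 7 p3 p3 (ask 6 8 p3 p3 (found (marked front blue) (8 ∷ 6 ∷ 7 ∷ 4 ∷ 3 ∷ 2 ∷ 5 ∷ 9 ∷ []) 8)))) (ask 6 7 p3 p3 (ask 6 9 p3 p3 (found bare (8 ∷ 5 ∷ 2 ∷ 3 ∷ 4 ∷ 7 ∷ 6 ∷ 9 ∷ []) 8)))) p3 (ask 7 8 (ask 6 8 p3 p3 (ask 7 9 p3 (ask 7 10 p3 p3 (found (marked front red) (8 ∷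 6 ∷ 5 ∷ 2 ∷ 3 ∷ 4 ∷ 7 ∷ 10 ∷ []) 9)) (found bare (8 ∷ 6 ∷ 5 ∷ 2 ∷ 3 ∷ 4 ∷ 7 ∷ 9 ∷ []) 8))) (ask 6 8 (ask 6 9 p3 p3 (ask 9 8 p3 p3 (found (marked front blue) (7 ∷ 4 ∷ 3 ∷ 2 ∷ 5 ∷ 6 ∷ 9 ∷ 8 ∷ []) 8))) p3 (ask 7 9 (ask 7 10 p3 p3 (found (marked front blue) (8 ∷ 6 ∷ 5 ∷ 2 ∷ 3 ∷ 4 ∷ 7 ∷ 10 ∷ []) 9)) p3 (found bare (8 ∷ 6 ∷ 5 ∷ 2 ∷ 3 ∷ 4 ∷ 7 ∷ 9 ∷ []) 8))) (ask 6 9 (ask 6 10 p3 p3 (found bare (8 ∷ 7 ∷ 4 ∷ 3 ∷ 2 ∷ 5 ∷ 6 ∷ 10 ∷ []) 9)) p3 (found bare (8 ∷ 7 ∷ 4 ∷ 3 ∷ 2 ∷ 5 ∷ 6 ∷ 9 ∷ []) 8))))) (ask 5 7 (ask 5 8 p3 (ask 5 9 p3 p3 (ask 6 7 p3 (ask 9 7 p3 p3 (ask 7 8 p3 p3 (found (marked front blue) (6 ∷ 4 ∷ 3 ∷ 2 ∷ 5 ∷ 9 ∷ 7 ∷ 8 ∷ []) 8))) (ask 7 8 p3 p3 (found bare (8 ∷ 7 ∷ 6 ∷ 4 ∷ 3 ∷ 2 ∷ 5 ∷ 9 ∷ []) 8)))) (ask 6 7 p3 (ask 6 9 (ask 6 10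 p3 p3 (ask 7 8 p3 p3 (found (marked front red) (7 ∷ 8 ∷ 5 ∷ 2 ∷ 3 ∷ 4 ∷ 6 ∷ 10 ∷ []) 9))) p3 (ask 7 8 p3 p3 (found bare (7 ∷ 8 ∷ 5 ∷ 2 ∷ 3 ∷ 4 ∷ 6 ∷ 9 ∷ []) 8))) (ask 7 9 p3 (ask 7 10 p3 p3 (found bare (8 ∷ 5 ∷ 2 ∷ 3 ∷ 4 ∷ 6 ∷ 7 ∷ 10 ∷ []) 9)) (found bare (8 ∷ 5 ∷ 2 ∷ 3 ∷ 4 ∷ 6 ∷ 7 ∷ 9 ∷ []) 8)))) (ask 5 8 (ask 5 9 p3 p3 (ask 6 7 (ask 9 7 p3 p3 (ask 7 8 p3 p3 (found (marked front red) (6 ∷ 4 ∷ 3 ∷ 2 ∷ 5 ∷ 9 ∷ 7 ∷ 8 ∷ []) 8))) p3 (ask 7 8 p3 p3 (found bare (8 ∷ 7 ∷ 6 ∷ 4 ∷ 3 ∷ 2 ∷ 5 ∷ 9 ∷ []) 8)))) p3 (ask 6 7 (ask 6 9 p3 (ask 6 10 p3 p3 (ask 7 8 p3 p3 (found (marked front red) (7 ∷ 8 ∷ 5 ∷ 2 ∷ 3 ∷ 4 ∷ 6 ∷ 10 ∷ []) 9))) (ask 7 8 p3 p3 (found bare (7 ∷ 8 ∷ 5 ∷ 2 ∷ 3 ∷ 4 ∷ 6 ∷ 9 ∷ []) 8))) p3 (ask 7 9 (ask 7 10 p3 p3 (found bare (8 ∷ 5 ∷ 2 ∷ 3 ∷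 4 ∷ 6 ∷ 7 ∷ 10 ∷ []) 9)) p3 (found bare (8 ∷ 5 ∷ 2 ∷ 3 ∷ 4 ∷ 6 ∷ 7 ∷ 9 ∷ []) 8)))) (ask 6 8 (ask 6 9 p3 (ask 6 10 p3 p3 (ask 7 8 p3 (ask 10 8 p3 p3 (found (marked front blue) (7 ∷ 5 ∷ 2 ∷ 3 ∷ 4 ∷ 6 ∷ 10 ∷ 8 ∷ []) 9)) (found bare (8 ∷ 7 ∷ 5 ∷ 2 ∷ 3 ∷ 4 ∷ 6 ∷ 10 ∷ []) 9))) (ask 7 8 p3 (ask 7 10 (ask 9 8 p3 p3 (found (marked front red) (7 ∷ 5 ∷ 2 ∷ 3 ∷ 4 ∷ 6 ∷ 9 ∷ 8 ∷ []) 9)) p3 (found bare (9 ∷ 6 ∷ 4 ∷ 3 ∷ 2 ∷ 5 ∷ 7 ∷ 10 ∷ []) 9)) (found bare (8 ∷ 7 ∷ 5 ∷ 2 ∷ 3 ∷ 4 ∷ 6 ∷ 9 ∷ []) 8))) (ask 6 9 (ask 6 10 p3 p3 (ask 7 8 (ask 10 8 p3 p3 (found (marked front red) (7 ∷ 5 ∷ 2 ∷ 3 ∷ 4 ∷ 6 ∷ 10 ∷ 8 ∷ []) 9)) p3 (found bare (8 ∷ 7 ∷ 5 ∷ 2 ∷ 3 ∷ 4 ∷ 6 ∷ 10 ∷ []) 9))) p3 (ask 7 8 (ask 7 10 p3 (ask 9 8 p3 p3 (found (marked front red) (7 ∷ 5 ∷ 2 ∷ 3 ∷ 4 ∷ 6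 ∷ 9 ∷ 8 ∷ []) 9)) (found bare (9 ∷ 6 ∷ 4 ∷ 3 ∷ 2 ∷ 5 ∷ 7 ∷ 10 ∷ []) 9)) p3 (found bare (8 ∷ 7 ∷ 5 ∷ 2 ∷ 3 ∷ 4 ∷ 6 ∷ 9 ∷ []) 8))) (ask 7 9 (ask 7 10 p3 (ask 7 11 p3 p3 (found bare (8 ∷ 6 ∷ 4 ∷ 3 ∷ 2 ∷ 5 ∷ 7 ∷ 11 ∷ []) 10)) (found bare (8 ∷ 6 ∷ 4 ∷ 3 ∷ 2 ∷ 5 ∷ 7 ∷ 10 ∷ []) 9)) (ask 7 10 (ask 7 11 p3 p3 (found bare (8 ∷ 6 ∷ 4 ∷ 3 ∷ 2 ∷ 5 ∷ 7 ∷ 11 ∷ []) 10)) p3 (found bare (8 ∷ 6 ∷ 4 ∷ 3 ∷ 2 ∷ 5 ∷ 7 ∷ 10 ∷ []) 9)) (found bare (8 ∷ 6 ∷ 4 ∷ 3 ∷ 2 ∷ 5 ∷ 7 ∷ 9 ∷ []) 8))))))) (ask 2 5 (ask 2 6 p3 p3 (ask 3 4 (ask 6 4 p3 p3 (ask 4 7 p3 p3 (ask 5 8 p3 (ask 3 8 p3 p3 (ask 5 7 p3 p3 (ask 5 9 p3 p3 (found (marked front blue) (8 ∷ 3 ∷ 2 ∷ 6 ∷ 4 ∷ 7 ∷ 5 ∷ 9 ∷ []) 8)))) (ask 3 9 p3 (ask 3 8 p3 p3 (ask 5 9 p3 p3 (found (marked back blue) (7 ∷ 4 ∷ 6 ∷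 2 ∷ 3 ∷ 8 ∷ 5 ∷ 9 ∷ []) 8))) (ask 5 7 p3 (ask 5 9 p3 p3 (found (marked front blue) (7 ∷ 4 ∷ 6 ∷ 2 ∷ 3 ∷ 9 ∷ 5 ∷ 8 ∷ []) 8)) (found bare (8 ∷ 5 ∷ 7 ∷ 4 ∷ 6 ∷ 2 ∷ 3 ∷ 9 ∷ []) 8)))))) p3 (ask 4 5 p3 p3 (ask 6 7 (ask 6 8 p3 (ask 5 8 p3 p3 (ask 6 9 p3 p3 (ask 7 8 p3 p3 (found (marked front red) (7 ∷ 8 ∷ 5 ∷ 4 ∷ 3 ∷ 2 ∷ 6 ∷ 9 ∷ []) 8)))) (ask 5 9 p3 (ask 5 7 p3 p3 (ask 7 9 p3 p3 (found (marked back blue) (8 ∷ 6 ∷ 2 ∷ 3 ∷ 4 ∷ 5 ∷ 7 ∷ 9 ∷ []) 8))) (ask 7 8 p3 (ask 7 9 p3 p3 (found (marked front red) (7 ∷ 9 ∷ 5 ∷ 4 ∷ 3 ∷ 2 ∷ 6 ∷ 8 ∷ []) 8)) (found bare (7 ∷ 8 ∷ 6 ∷ 2 ∷ 3 ∷ 4 ∷ 5 ∷ 9 ∷ []) 8)))) (ask 6 8 (ask 5 7 p3 p3 (ask 6 9 p3 p3 (ask 7 8 p3 p3 (found (marked front red) (8 ∷ 7 ∷ 5 ∷ 4 ∷ 3 ∷ 2 ∷ 6 ∷ 9 ∷ []) 8)))) p3 (ask 8 7 (ask 5 7 p3 p3 (ask 7 9 p3 p3 (found (marked front red) (8 ∷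 6 ∷ 2 ∷ 3 ∷ 4 ∷ 5 ∷ 7 ∷ 9 ∷ []) 8))) p3 (ask 5 9 p3 (ask 5 10 p3 p3 (found (marked front blue) (7 ∷ 8 ∷ 6 ∷ 2 ∷ 3 ∷ 4 ∷ 5 ∷ 10 ∷ []) 9)) (found bare (7 ∷ 8 ∷ 6 ∷ 2 ∷ 3 ∷ 4 ∷ 5 ∷ 9 ∷ []) 8)))) (ask 7 8 (ask 5 8 p3 (ask 5 9 p3 p3 (ask 9 8 p3 p3 (found (marked front red) (7 ∷ 6 ∷ 2 ∷ 3 ∷ 4 ∷ 5 ∷ 9 ∷ 8 ∷ []) 8))) (ask 7 9 p3 (ask 7 10 p3 p3 (found (marked front red) (8 ∷ 5 ∷ 4 ∷ 3 ∷ 2 ∷ 6 ∷ 7 ∷ 10 ∷ []) 9)) (found bare (8 ∷ 5 ∷ 4 ∷ 3 ∷ 2 ∷ 6 ∷ 7 ∷ 9 ∷ []) 8))) (ask 5 8 p3 p3 (ask 7 9 (ask 7 10 p3 p3 (found (marked front blue) (8 ∷ 5 ∷ 4 ∷ 3 ∷ 2 ∷ 6 ∷ 7 ∷ 10 ∷ []) 9)) p3 (found bare (8 ∷ 5 ∷ 4 ∷ 3 ∷ 2 ∷ 6 ∷ 7 ∷ 9 ∷ []) 8))) (ask 5 9 p3 (ask 5 10 p3 p3 (found bare (8 ∷ 7 ∷ 6 ∷ 2 ∷ 3 ∷ 4 ∷ 5 ∷ 10 ∷ []) 9)) (found bare (8 ∷ 7 ∷ 6 ∷ 2 ∷ 3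 ∷ 4 ∷ 5 ∷ 9 ∷ []) 8))))))) p3 (ask 3 4 (ask 3 6 p3 (ask 3 7 p3 p3 (ask 4 5 p3 p3 (ask 7 6 (ask 4 8 p3 p3 (ask 6 8 p3 p3 (ask 6 9 p3 p3 (found (marked front red) (7 ∷ 3 ∷ 2 ∷ 5 ∷ 4 ∷ 8 ∷ 6 ∷ 9 ∷ []) 8)))) p3 (ask 6 8 (ask 4 8 p3 p3 (ask 6 9 p3 p3 (found (marked front red) (8 ∷ 4 ∷ 5 ∷ 2 ∷ 3 ∷ 7 ∷ 6 ∷ 9 ∷ []) 8))) p3 (ask 4 9 p3 p3 (found bare (8 ∷ 6 ∷ 7 ∷ 3 ∷ 2 ∷ 5 ∷ 4 ∷ 9 ∷ []) 8)))))) (ask 4 5 p3 p3 (ask 6 7 (ask 6 8 p3 (ask 4 7 p3 p3 (ask 6 9 p3 p3 (ask 7 8 p3 p3 (found (marked front blue) (8 ∷ 7 ∷ 4 ∷ 5 ∷ 2 ∷ 3 ∷ 6 ∷ 9 ∷ []) 8)))) (ask 4 9 p3 p3 (ask 7 8 p3 (ask 7 9 p3 p3 (found (marked front red) (7 ∷ 9 ∷ 4 ∷ 5 ∷ 2 ∷ 3 ∷ 6 ∷ 8 ∷ []) 8)) (found bare (7 ∷ 8 ∷ 6 ∷ 3 ∷ 2 ∷ 5 ∷ 4 ∷ 9 ∷ []) 8)))) (ask 6 8 (ask 4 7 p3 p3 (ask 6 9 p3 p3 (ask 7 8 p3 p3 (found (marked front red) (8 ∷ 7 ∷ 4 ∷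 5 ∷ 2 ∷ 3 ∷ 6 ∷ 9 ∷ []) 8)))) p3 (ask 4 9 p3 p3 (ask 7 8 (ask 7 9 p3 p3 (found (marked front red) (7 ∷ 9 ∷ 4 ∷ 5 ∷ 2 ∷ 3 ∷ 6 ∷ 8 ∷ []) 8)) p3 (found bare (7 ∷ 8 ∷ 6 ∷ 3 ∷ 2 ∷ 5 ∷ 4 ∷ 9 ∷ []) 8)))) (ask 7 8 (ask 4 8 p3 p3 (ask 7 9 p3 (ask 7 10 p3 p3 (found (marked front red) (8 ∷ 4 ∷ 5 ∷ 2 ∷ 3 ∷ 6 ∷ 7 ∷ 10 ∷ []) 9)) (found bare (8 ∷ 4 ∷ 5 ∷ 2 ∷ 3 ∷ 6 ∷ 7 ∷ 9 ∷ []) 8))) (ask 4 8 p3 p3 (ask 7 9 (ask 7 10 p3 p3 (found (marked front blue) (8 ∷ 4 ∷ 5 ∷ 2 ∷ 3 ∷ 6 ∷ 7 ∷ 10 ∷ []) 9)) p3 (found bare (8 ∷ 4 ∷ 5 ∷ 2 ∷ 3 ∷ 6 ∷ 7 ∷ 9 ∷ []) 8))) (ask 4 9 p3 p3 (found bare (8 ∷ 7 ∷ 6 ∷ 3 ∷ 2 ∷ 5 ∷ 4 ∷ 9 ∷ []) 8)))))) p3 (ask 4 6 (ask 4 7 p3 p3 (ask 5 6 p3 (ask 5 8 (ask 5 9 p3 p3 (ask 6 7 p3 p3 (ask 6 8 p3 p3 (found (marked front red) (8 ∷ 6 ∷ 7 ∷ 4 ∷ 3 ∷ 2 ∷ 5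 ∷ 9 ∷ []) 8)))) p3 (ask 6 7 p3 p3 (ask 6 9 p3 p3 (found bare (8 ∷ 5 ∷ 2 ∷ 3 ∷ 4 ∷ 7 ∷ 6 ∷ 9 ∷ []) 8)))) (ask 7 8 (ask 6 8 p3 (ask 6 9 p3 p3 (ask 9 8 p3 p3 (found (marked front red) (7 ∷ 4 ∷ 3 ∷ 2 ∷ 5 ∷ 6 ∷ 9 ∷ 8 ∷ []) 8))) (ask 7 9 p3 (ask 7 10 p3 p3 (found (marked front red) (8 ∷ 6 ∷ 5 ∷ 2 ∷ 3 ∷ 4 ∷ 7 ∷ 10 ∷ []) 9)) (found bare (8 ∷ 6 ∷ 5 ∷ 2 ∷ 3 ∷ 4 ∷ 7 ∷ 9 ∷ []) 8))) (ask 6 8 p3 p3 (ask 7 9 (ask 7 10 p3 p3 (found (marked front blue) (8 ∷ 6 ∷ 5 ∷ 2 ∷ 3 ∷ 4 ∷ 7 ∷ 10 ∷ []) 9)) p3 (found bare (8 ∷ 6 ∷ 5 ∷ 2 ∷ 3 ∷ 4 ∷ 7 ∷ 9 ∷ []) 8))) (ask 6 9 p3 (ask 6 10 p3 p3 (found bare (8 ∷ 7 ∷ 4 ∷ 3 ∷ 2 ∷ 5 ∷ 6 ∷ 10 ∷ []) 9)) (found bare (8 ∷ 7 ∷ 4 ∷ 3 ∷ 2 ∷ 5 ∷ 6 ∷ 9 ∷ []) 8))))) p3 (ask 5 7 (ask 5 8 p3 (ask 5 9 p3 p3 (ask 6 7 p3 (ask 9 7 p3 p3 (ask 7 8 p3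 p3 (found (marked front blue) (6 ∷ 4 ∷ 3 ∷ 2 ∷ 5 ∷ 9 ∷ 7 ∷ 8 ∷ []) 8))) (ask 7 8 p3 p3 (found bare (8 ∷ 7 ∷ 6 ∷ 4 ∷ 3 ∷ 2 ∷ 5 ∷ 9 ∷ []) 8)))) (ask 6 7 p3 (ask 6 9 (ask 6 10 p3 p3 (ask 7 8 p3 p3 (found (marked front red) (7 ∷ 8 ∷ 5 ∷ 2 ∷ 3 ∷ 4 ∷ 6 ∷ 10 ∷ []) 9))) p3 (ask 7 8 p3 p3 (found bare (7 ∷ 8 ∷ 5 ∷ 2 ∷ 3 ∷ 4 ∷ 6 ∷ 9 ∷ []) 8))) (ask 7 9 p3 (ask 7 10 p3 p3 (found bare (8 ∷ 5 ∷ 2 ∷ 3 ∷ 4 ∷ 6 ∷ 7 ∷ 10 ∷ []) 9)) (found bare (8 ∷ 5 ∷ 2 ∷ 3 ∷ 4 ∷ 6 ∷ 7 ∷ 9 ∷ []) 8)))) (ask 5 8 (ask 5 9 p3 p3 (ask 6 7 (ask 9 7 p3 p3 (ask 7 8 p3 p3 (found (marked front red) (6 ∷ 4 ∷ 3 ∷ 2 ∷ 5 ∷ 9 ∷ 7 ∷ 8 ∷ []) 8))) p3 (ask 7 8 p3 p3 (found bare (8 ∷ 7 ∷ 6 ∷ 4 ∷ 3 ∷ 2 ∷ 5 ∷ 9 ∷ []) 8)))) p3 (ask 6 7 (ask 6 9 p3 (ask 6 10 p3 p3 (ask 7 8 p3 p3 (found (marked front red) (7 ∷ 8 ∷ 5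 ∷ 2 ∷ 3 ∷ 4 ∷ 6 ∷ 10 ∷ []) 9))) (ask 7 8 p3 p3 (found bare (7 ∷ 8 ∷ 5 ∷ 2 ∷ 3 ∷ 4 ∷ 6 ∷ 9 ∷ []) 8))) p3 (ask 7 9 (ask 7 10 p3 p3 (found bare (8 ∷ 5 ∷ 2 ∷ 3 ∷ 4 ∷ 6 ∷ 7 ∷ 10 ∷ []) 9)) p3 (found bare (8 ∷ 5 ∷ 2 ∷ 3 ∷ 4 ∷ 6 ∷ 7 ∷ 9 ∷ []) 8)))) (ask 6 8 (ask 6 9 p3 (ask 6 10 p3 p3 (ask 7 8 p3 (ask 10 8 p3 p3 (found (marked front blue) (7 ∷ 5 ∷ 2 ∷ 3 ∷ 4 ∷ 6 ∷ 10 ∷ 8 ∷ []) 9)) (found bare (8 ∷ 7 ∷ 5 ∷ 2 ∷ 3 ∷ 4 ∷ 6 ∷ 10 ∷ []) 9))) (ask 7 8 p3 (ask 7 10 (ask 9 8 p3 p3 (found (marked front red) (7 ∷ 5 ∷ 2 ∷ 3 ∷ 4 ∷ 6 ∷ 9 ∷ 8 ∷ []) 9)) p3 (found bare (9 ∷ 6 ∷ 4 ∷ 3 ∷ 2 ∷ 5 ∷ 7 ∷ 10 ∷ []) 9)) (found bare (8 ∷ 7 ∷ 5 ∷ 2 ∷ 3 ∷ 4 ∷ 6 ∷ 9 ∷ []) 8))) (ask 6 9 (ask 6 10 p3 p3 (ask 7 8 (ask 10 8 p3 p3 (found (marked front red) (7 ∷ 5 ∷ 2 ∷ 3 ∷ 4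 ∷ 6 ∷ 10 ∷ 8 ∷ []) 9)) p3 (found bare (8 ∷ 7 ∷ 5 ∷ 2 ∷ 3 ∷ 4 ∷ 6 ∷ 10 ∷ []) 9))) p3 (ask 7 8 (ask 7 10 p3 (ask 9 8 p3 p3 (found (marked front red) (7 ∷ 5 ∷ 2 ∷ 3 ∷ 4 ∷ 6 ∷ 9 ∷ 8 ∷ []) 9)) (found bare (9 ∷ 6 ∷ 4 ∷ 3 ∷ 2 ∷ 5 ∷ 7 ∷ 10 ∷ []) 9)) p3 (found bare (8 ∷ 7 ∷ 5 ∷ 2 ∷ 3 ∷ 4 ∷ 6 ∷ 9 ∷ []) 8))) (ask 7 9 (ask 7 10 p3 (ask 7 11 p3 p3 (found bare (8 ∷ 6 ∷ 4 ∷ 3 ∷ 2 ∷ 5 ∷ 7 ∷ 11 ∷ []) 10)) (found bare (8 ∷ 6 ∷ 4 ∷ 3 ∷ 2 ∷ 5 ∷ 7 ∷ 10 ∷ []) 9)) (ask 7 10 (ask 7 11 p3 p3 (found bare (8 ∷ 6 ∷ 4 ∷ 3 ∷ 2 ∷ 5 ∷ 7 ∷ 11 ∷ []) 10)) p3 (found bare (8 ∷ 6 ∷ 4 ∷ 3 ∷ 2 ∷ 5 ∷ 7 ∷ 10 ∷ []) 9)) (found bare (8 ∷ 6 ∷ 4 ∷ 3 ∷ 2 ∷ 5 ∷ 7 ∷ 9 ∷ []) 8))))))) (ask 3 5 (ask 3 6 p3 (ask 3 7 p3 p3 (ask 4 5 p3 (ask 4 6 (ask 4 8 p3 p3 (ask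 5 7 p3 p3 (ask 5 9 p3 p3 (ask 6 8 p3 p3 (found (marked front red) (6 ∷ 8 ∷ 4 ∷ 2 ∷ 3 ∷ 7 ∷ 5 ∷ 9 ∷ []) 8))))) p3 (ask 5 7 p3 p3 (ask 6 8 (ask 5 8 p3 p3 (ask 6 9 p3 p3 (found (marked front red) (8 ∷ 5 ∷ 7 ∷ 3 ∷ 2 ∷ 4 ∷ 6 ∷ 9 ∷ []) 8))) p3 (ask 5 9 p3 p3 (found bare (8 ∷ 6 ∷ 4 ∷ 2 ∷ 3 ∷ 7 ∷ 5 ∷ 9 ∷ []) 8))))) (ask 5 6 p3 p3 (ask 7 8 (ask 6 8 p3 p3 (ask 7 9 p3 (ask 7 10 p3 p3 (found (marked front red) (8 ∷ 6 ∷ 5 ∷ 4 ∷ 2 ∷ 3 ∷ 7 ∷ 10 ∷ []) 9)) (found bare (8 ∷ 6 ∷ 5 ∷ 4 ∷ 2 ∷ 3 ∷ 7 ∷ 9 ∷ []) 8))) (ask 6 8 (ask 6 9 p3 p3 (ask 9 8 p3 p3 (found (marked front blue) (7 ∷ 3 ∷ 2 ∷ 4 ∷ 5 ∷ 6 ∷ 9 ∷ 8 ∷ []) 8))) p3 (ask 7 9 (ask 7 10 p3 p3 (found (marked front blue) (8 ∷ 6 ∷ 5 ∷ 4 ∷ 2 ∷ 3 ∷ 7 ∷ 10 ∷ []) 9)) p3 (found bare (8 ∷ 6 ∷ 5 ∷ 4 ∷ 2 ∷ 3 ∷ 7 ∷ 9 ∷ []) 8))) (ask 6 9 (ask 6 10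 p3 p3 (found bare (8 ∷ 7 ∷ 3 ∷ 2 ∷ 4 ∷ 5 ∷ 6 ∷ 10 ∷ []) 9)) p3 (found bare (8 ∷ 7 ∷ 3 ∷ 2 ∷ 4 ∷ 5 ∷ 6 ∷ 9 ∷ []) 8)))))) (ask 4 5 p3 (ask 4 7 (ask 4 8 p3 p3 (ask 5 6 p3 p3 (ask 5 9 p3 p3 (ask 7 8 p3 (ask 7 9 p3 p3 (found (marked front red) (7 ∷ 9 ∷ 5 ∷ 6 ∷ 3 ∷ 2 ∷ 4 ∷ 8 ∷ []) 8)) (found bare (7 ∷ 8 ∷ 4 ∷ 2 ∷ 3 ∷ 6 ∷ 5 ∷ 9 ∷ []) 8))))) p3 (ask 5 6 p3 p3 (ask 7 8 (ask 5 8 p3 p3 (ask 7 9 p3 (ask 7 10 p3 p3 (found (marked front red) (8 ∷ 5 ∷ 6 ∷ 3 ∷ 2 ∷ 4 ∷ 7 ∷ 10 ∷ []) 9)) (found bare (8 ∷ 5 ∷ 6 ∷ 3 ∷ 2 ∷ 4 ∷ 7 ∷ 9 ∷ []) 8))) (ask 5 8 p3 p3 (ask 7 9 (ask 7 10 p3 p3 (found (marked front blue) (8 ∷ 5 ∷ 6 ∷ 3 ∷ 2 ∷ 4 ∷ 7 ∷ 10 ∷ []) 9)) p3 (found bare (8 ∷ 5 ∷ 6 ∷ 3 ∷ 2 ∷ 4 ∷ 7 ∷ 9 ∷ []) 8))) (ask 5 9 p3 p3 (found bare (8 ∷ 7 ∷ 4 ∷ 2 ∷ 3 ∷ 6 ∷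 5 ∷ 9 ∷ []) 8))))) (ask 5 7 p3 (ask 5 8 p3 p3 (ask 6 7 (ask 6 9 p3 (ask 6 10 p3 p3 (ask 7 8 p3 p3 (found (marked front red) (7 ∷ 8 ∷ 5 ∷ 4 ∷ 2 ∷ 3 ∷ 6 ∷ 10 ∷ []) 9))) (ask 7 8 p3 p3 (found bare (7 ∷ 8 ∷ 5 ∷ 4 ∷ 2 ∷ 3 ∷ 6 ∷ 9 ∷ []) 8))) p3 (ask 7 9 (ask 7 10 p3 p3 (found bare (8 ∷ 5 ∷ 4 ∷ 2 ∷ 3 ∷ 6 ∷ 7 ∷ 10 ∷ []) 9)) p3 (found bare (8 ∷ 5 ∷ 4 ∷ 2 ∷ 3 ∷ 6 ∷ 7 ∷ 9 ∷ []) 8)))) (ask 6 8 (ask 6 9 p3 (ask 6 10 p3 p3 (ask 7 8 p3 (ask 10 8 p3 p3 (found (marked front blue) (7 ∷ 5 ∷ 4 ∷ 2 ∷ 3 ∷ 6 ∷ 10 ∷ 8 ∷ []) 9)) (found bare (8 ∷ 7 ∷ 5 ∷ 4 ∷ 2 ∷ 3 ∷ 6 ∷ 10 ∷ []) 9))) (ask 7 8 p3 (ask 7 10 (ask 9 8 p3 p3 (found (marked front red) (7 ∷ 5 ∷ 4 ∷ 2 ∷ 3 ∷ 6 ∷ 9 ∷ 8 ∷ []) 9)) p3 (found bare (9 ∷ 6 ∷ 3 ∷ 2 ∷ 4 ∷ 5 ∷ 7 ∷ 10 ∷ []) 9)) (found bare (8 ∷ 7 ∷ 5 ∷ 4 ∷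 2 ∷ 3 ∷ 6 ∷ 9 ∷ []) 8))) (ask 6 9 (ask 6 10 p3 p3 (ask 7 8 (ask 10 8 p3 p3 (found (marked front red) (7 ∷ 5 ∷ 4 ∷ 2 ∷ 3 ∷ 6 ∷ 10 ∷ 8 ∷ []) 9)) p3 (found bare (8 ∷ 7 ∷ 5 ∷ 4 ∷ 2 ∷ 3 ∷ 6 ∷ 10 ∷ []) 9))) p3 (ask 7 8 (ask 7 10 p3 (ask 9 8 p3 p3 (found (marked front red) (7 ∷ 5 ∷ 4 ∷ 2 ∷ 3 ∷ 6 ∷ 9 ∷ 8 ∷ []) 9)) (found bare (9 ∷ 6 ∷ 3 ∷ 2 ∷ 4 ∷ 5 ∷ 7 ∷ 10 ∷ []) 9)) p3 (found bare (8 ∷ 7 ∷ 5 ∷ 4 ∷ 2 ∷ 3 ∷ 6 ∷ 9 ∷ []) 8))) (ask 7 9 (ask 7 10 p3 (ask 7 11 p3 p3 (found bare (8 ∷ 6 ∷ 3 ∷ 2 ∷ 4 ∷ 5 ∷ 7 ∷ 11 ∷ []) 10)) (found bare (8 ∷ 6 ∷ 3 ∷ 2 ∷ 4 ∷ 5 ∷ 7 ∷ 10 ∷ []) 9)) (ask 7 10 (ask 7 11 p3 p3 (found bare (8 ∷ 6 ∷ 3 ∷ 2 ∷ 4 ∷ 5 ∷ 7 ∷ 11 ∷ []) 10)) p3 (found bare (8 ∷ 6 ∷ 3 ∷ 2 ∷ 4 ∷ 5 ∷ 7 ∷ 10 ∷ []) 9)) (found bare (8 ∷ 6 ∷ 3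 ∷ 2 ∷ 4 ∷ 5 ∷ 7 ∷ 9 ∷ []) 8)))))) (ask 3 6 (ask 3 7 p3 p3 (ask 4 5 (ask 4 6 p3 (ask 4 8 p3 p3 (ask 5 7 p3 p3 (ask 5 9 p3 p3 (ask 6 8 p3 p3 (found (marked front red) (6 ∷ 8 ∷ 4 ∷ 2 ∷ 3 ∷ 7 ∷ 5 ∷ 9 ∷ []) 8))))) (ask 5 7 p3 p3 (ask 6 8 p3 (ask 5 8 p3 p3 (ask 6 9 p3 p3 (found (marked front blue) (8 ∷ 5 ∷ 7 ∷ 3 ∷ 2 ∷ 4 ∷ 6 ∷ 9 ∷ []) 8))) (ask 5 9 p3 p3 (found bare (8 ∷ 6 ∷ 4 ∷ 2 ∷ 3 ∷ 7 ∷ 5 ∷ 9 ∷ []) 8))))) p3 (ask 5 6 p3 p3 (ask 7 8 (ask 6 8 p3 (ask 6 9 p3 p3 (ask 9 8 p3 p3 (found (marked front red) (7 ∷ 3 ∷ 2 ∷ 4 ∷ 5 ∷ 6 ∷ 9 ∷ 8 ∷ []) 8))) (ask 7 9 p3 (ask 7 10 p3 p3 (found (marked front red) (8 ∷ 6 ∷ 5 ∷ 4 ∷ 2 ∷ 3 ∷ 7 ∷ 10 ∷ []) 9)) (found bare (8 ∷ 6 ∷ 5 ∷ 4 ∷ 2 ∷ 3 ∷ 7 ∷ 9 ∷ []) 8))) (ask 6 8 p3 p3 (ask 7 9 (ask 7 10 p3 p3 (found (marked front blue) (8 ∷ 6 ∷ 5 ∷ 4 ∷ 2 ∷ 3 ∷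 7 ∷ 10 ∷ []) 9)) p3 (found bare (8 ∷ 6 ∷ 5 ∷ 4 ∷ 2 ∷ 3 ∷ 7 ∷ 9 ∷ []) 8))) (ask 6 9 p3 (ask 6 10 p3 p3 (found bare (8 ∷ 7 ∷ 3 ∷ 2 ∷ 4 ∷ 5 ∷ 6 ∷ 10 ∷ []) 9)) (found bare (8 ∷ 7 ∷ 3 ∷ 2 ∷ 4 ∷ 5 ∷ 6 ∷ 9 ∷ []) 8)))))) p3 (ask 4 5 (ask 4 7 p3 (ask 4 8 p3 p3 (ask 5 6 p3 p3 (ask 5 9 p3 p3 (ask 7 8 (ask 7 9 p3 p3 (found (marked front red) (7 ∷ 9 ∷ 5 ∷ 6 ∷ 3 ∷ 2 ∷ 4 ∷ 8 ∷ []) 8)) p3 (found bare (7 ∷ 8 ∷ 4 ∷ 2 ∷ 3 ∷ 6 ∷ 5 ∷ 9 ∷ []) 8))))) (ask 5 6 p3 p3 (ask 7 8 (ask 5 8 p3 p3 (ask 7 9 p3 (ask 7 10 p3 p3 (found (marked front red) (8 ∷ 5 ∷ 6 ∷ 3 ∷ 2 ∷ 4 ∷ 7 ∷ 10 ∷ []) 9)) (found bare (8 ∷ 5 ∷ 6 ∷ 3 ∷ 2 ∷ 4 ∷ 7 ∷ 9 ∷ []) 8))) (ask 5 8 p3 p3 (ask 7 9 (ask 7 10 p3 p3 (found (marked front blue) (8 ∷ 5 ∷ 6 ∷ 3 ∷ 2 ∷ 4 ∷ 7 ∷ 10 ∷ []) 9)) p3 (found bare (8 ∷ 5 ∷ 6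 ∷ 3 ∷ 2 ∷ 4 ∷ 7 ∷ 9 ∷ []) 8))) (ask 5 9 p3 p3 (found bare (8 ∷ 7 ∷ 4 ∷ 2 ∷ 3 ∷ 6 ∷ 5 ∷ 9 ∷ []) 8))))) p3 (ask 5 7 (ask 5 8 p3 p3 (ask 6 7 p3 (ask 6 9 (ask 6 10 p3 p3 (ask 7 8 p3 p3 (found (marked front red) (7 ∷ 8 ∷ 5 ∷ 4 ∷ 2 ∷ 3 ∷ 6 ∷ 10 ∷ []) 9))) p3 (ask 7 8 p3 p3 (found bare (7 ∷ 8 ∷ 5 ∷ 4 ∷ 2 ∷ 3 ∷ 6 ∷ 9 ∷ []) 8))) (ask 7 9 p3 (ask 7 10 p3 p3 (found bare (8 ∷ 5 ∷ 4 ∷ 2 ∷ 3 ∷ 6 ∷ 7 ∷ 10 ∷ []) 9)) (found bare (8 ∷ 5 ∷ 4 ∷ 2 ∷ 3 ∷ 6 ∷ 7 ∷ 9 ∷ []) 8)))) p3 (ask 6 8 (ask 6 9 p3 (ask 6 10 p3 p3 (ask 7 8 p3 (ask 10 8 p3 p3 (found (marked front blue) (7 ∷ 5 ∷ 4 ∷ 2 ∷ 3 ∷ 6 ∷ 10 ∷ 8 ∷ []) 9)) (found bare (8 ∷ 7 ∷ 5 ∷ 4 ∷ 2 ∷ 3 ∷ 6 ∷ 10 ∷ []) 9))) (ask 7 8 p3 (ask 7 10 (ask 9 8 p3 p3 (found (marked front red) (7 ∷ 5 ∷ 4 ∷ 2 ∷ 3 ∷ 6 ∷ 9 ∷ 8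 ∷ []) 9)) p3 (found bare (9 ∷ 6 ∷ 3 ∷ 2 ∷ 4 ∷ 5 ∷ 7 ∷ 10 ∷ []) 9)) (found bare (8 ∷ 7 ∷ 5 ∷ 4 ∷ 2 ∷ 3 ∷ 6 ∷ 9 ∷ []) 8))) (ask 6 9 (ask 6 10 p3 p3 (ask 7 8 (ask 10 8 p3 p3 (found (marked front red) (7 ∷ 5 ∷ 4 ∷ 2 ∷ 3 ∷ 6 ∷ 10 ∷ 8 ∷ []) 9)) p3 (found bare (8 ∷ 7 ∷ 5 ∷ 4 ∷ 2 ∷ 3 ∷ 6 ∷ 10 ∷ []) 9))) p3 (ask 7 8 (ask 7 10 p3 (ask 9 8 p3 p3 (found (marked front red) (7 ∷ 5 ∷ 4 ∷ 2 ∷ 3 ∷ 6 ∷ 9 ∷ 8 ∷ []) 9)) (found bare (9 ∷ 6 ∷ 3 ∷ 2 ∷ 4 ∷ 5 ∷ 7 ∷ 10 ∷ []) 9)) p3 (found bare (8 ∷ 7 ∷ 5 ∷ 4 ∷ 2 ∷ 3 ∷ 6 ∷ 9 ∷ []) 8))) (ask 7 9 (ask 7 10 p3 (ask 7 11 p3 p3 (found bare (8 ∷ 6 ∷ 3 ∷ 2 ∷ 4 ∷ 5 ∷ 7 ∷ 11 ∷ []) 10)) (found bare (8 ∷ 6 ∷ 3 ∷ 2 ∷ 4 ∷ 5 ∷ 7 ∷ 10 ∷ []) 9)) (ask 7 10 (ask 7 11 p3 p3 (found bare (8 ∷ 6 ∷ 3 ∷ 2 ∷ 4 ∷ 5 ∷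 7 ∷ 11 ∷ []) 10)) p3 (found bare (8 ∷ 6 ∷ 3 ∷ 2 ∷ 4 ∷ 5 ∷ 7 ∷ 10 ∷ []) 9)) (found bare (8 ∷ 6 ∷ 3 ∷ 2 ∷ 4 ∷ 5 ∷ 7 ∷ 9 ∷ []) 8)))))) (ask 4 6 (ask 4 7 p3 (ask 4 8 p3 p3 (ask 5 6 p3 (ask 5 7 (ask 5 9 p3 p3 (ask 6 7 p3 p3 (ask 6 8 p3 p3 (found (marked front red) (7 ∷ 6 ∷ 8 ∷ 4 ∷ 2 ∷ 3 ∷ 5 ∷ 9 ∷ []) 8)))) p3 (ask 6 7 p3 p3 (ask 6 9 p3 p3 (found bare (8 ∷ 4 ∷ 2 ∷ 3 ∷ 5 ∷ 7 ∷ 6 ∷ 9 ∷ []) 8)))) (ask 6 7 p3 p3 (ask 7 9 (ask 7 10 p3 p3 (found bare (8 ∷ 4 ∷ 2 ∷ 3 ∷ 5 ∷ 6 ∷ 7 ∷ 10 ∷ []) 9)) p3 (found bare (8 ∷ 4 ∷ 2 ∷ 3 ∷ 5 ∷ 6 ∷ 7 ∷ 9 ∷ []) 8))))) (ask 5 6 p3 (ask 5 8 (ask 5 9 p3 p3 (ask 6 7 p3 p3 (ask 6 8 p3 p3 (found bare (8 ∷ 6 ∷ 7 ∷ 4 ∷ 2 ∷ 3 ∷ 5 ∷ 9 ∷ []) 8)))) p3 (ask 6 7 p3 p3 (ask 6 9 p3 p3 (found bare (8 ∷ 5 ∷ 3 ∷ 2 ∷ 4 ∷ 7 ∷ 6 ∷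 9 ∷ []) 8)))) (ask 6 8 p3 (ask 6 9 p3 p3 (ask 7 8 (ask 7 10 p3 (ask 9 8 p3 p3 (found (marked front red) (7 ∷ 4 ∷ 2 ∷ 3 ∷ 5 ∷ 6 ∷ 9 ∷ 8 ∷ []) 9)) (found bare (9 ∷ 6 ∷ 5 ∷ 3 ∷ 2 ∷ 4 ∷ 7 ∷ 10 ∷ []) 9)) p3 (found bare (8 ∷ 7 ∷ 4 ∷ 2 ∷ 3 ∷ 5 ∷ 6 ∷ 9 ∷ []) 8))) (ask 7 9 (ask 7 10 p3 (ask 7 11 p3 p3 (found bare (8 ∷ 6 ∷ 5 ∷ 3 ∷ 2 ∷ 4 ∷ 7 ∷ 11 ∷ []) 10)) (found bare (8 ∷ 6 ∷ 5 ∷ 3 ∷ 2 ∷ 4 ∷ 7 ∷ 10 ∷ []) 9)) (ask 7 10 (ask 7 11 p3 p3 (found bare (8 ∷ 6 ∷ 5 ∷ 3 ∷ 2 ∷ 4 ∷ 7 ∷ 11 ∷ []) 10)) p3 (found bare (8 ∷ 6 ∷ 5 ∷ 3 ∷ 2 ∷ 4 ∷ 7 ∷ 10 ∷ []) 9)) (found bare (8 ∷ 6 ∷ 5 ∷ 3 ∷ 2 ∷ 4 ∷ 7 ∷ 9 ∷ []) 8))))) (ask 4 7 (ask 4 8 p3 p3 (ask 5 6 (ask 5 7 p3 (ask 5 9 p3 p3 (ask 6 7 p3 p3 (ask 6 8 p3 p3 (found (marked front red) (7 ∷ 6 ∷ 8 ∷ 4 ∷ 2 ∷ 3 ∷ 5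 ∷ 9 ∷ []) 8)))) (ask 6 7 p3 p3 (ask 6 9 p3 p3 (found bare (8 ∷ 4 ∷ 2 ∷ 3 ∷ 5 ∷ 7 ∷ 6 ∷ 9 ∷ []) 8)))) p3 (ask 6 7 p3 p3 (ask 7 9 p3 (ask 7 10 p3 p3 (found bare (8 ∷ 4 ∷ 2 ∷ 3 ∷ 5 ∷ 6 ∷ 7 ∷ 10 ∷ []) 9)) (found bare (8 ∷ 4 ∷ 2 ∷ 3 ∷ 5 ∷ 6 ∷ 7 ∷ 9 ∷ []) 8))))) p3 (ask 5 6 (ask 5 8 p3 (ask 5 9 p3 p3 (ask 6 7 p3 p3 (ask 6 8 p3 p3 (found bare (8 ∷ 6 ∷ 7 ∷ 4 ∷ 2 ∷ 3 ∷ 5 ∷ 9 ∷ []) 8)))) (ask 6 7 p3 p3 (ask 6 9 p3 p3 (found bare (8 ∷ 5 ∷ 3 ∷ 2 ∷ 4 ∷ 7 ∷ 6 ∷ 9 ∷ []) 8)))) p3 (ask 6 8 (ask 6 9 p3 p3 (ask 7 8 p3 (ask 7 10 (ask 9 8 p3 p3 (found (marked front red) (7 ∷ 4 ∷ 2 ∷ 3 ∷ 5 ∷ 6 ∷ 9 ∷ 8 ∷ []) 9)) p3 (found bare (9 ∷ 6 ∷ 5 ∷ 3 ∷ 2 ∷ 4 ∷ 7 ∷ 10 ∷ []) 9)) (found bare (8 ∷ 7 ∷ 4 ∷ 2 ∷ 3 ∷ 5 ∷ 6 ∷ 9 ∷ []) 8))) p3 (ask 7 9 (ask 7 10 p3 (ask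 7 11 p3 p3 (found bare (8 ∷ 6 ∷ 5 ∷ 3 ∷ 2 ∷ 4 ∷ 7 ∷ 11 ∷ []) 10)) (found bare (8 ∷ 6 ∷ 5 ∷ 3 ∷ 2 ∷ 4 ∷ 7 ∷ 10 ∷ []) 9)) (ask 7 10 (ask 7 11 p3 p3 (found bare (8 ∷ 6 ∷ 5 ∷ 3 ∷ 2 ∷ 4 ∷ 7 ∷ 11 ∷ []) 10)) p3 (found bare (8 ∷ 6 ∷ 5 ∷ 3 ∷ 2 ∷ 4 ∷ 7 ∷ 10 ∷ []) 9)) (found bare (8 ∷ 6 ∷ 5 ∷ 3 ∷ 2 ∷ 4 ∷ 7 ∷ 9 ∷ []) 8))))) (ask 5 7 (ask 5 8 p3 (ask 5 9 p3 p3 (ask 6 7 p3 (ask 6 8 (ask 6 10 p3 p3 (ask 7 9 p3 p3 (found (marked front red) (7 ∷ 9 ∷ 5 ∷ 3 ∷ 2 ∷ 4 ∷ 6 ∷ 10 ∷ []) 9))) p3 (ask 7 8 p3 p3 (found bare (7 ∷ 8 ∷ 6 ∷ 4 ∷ 2 ∷ 3 ∷ 5 ∷ 9 ∷ []) 8))) (ask 7 8 p3 p3 (found bare (8 ∷ 7 ∷ 6 ∷ 4 ∷ 2 ∷ 3 ∷ 5 ∷ 9 ∷ []) 8)))) (ask 6 7 p3 (ask 6 9 (ask 6 10 p3 p3 (ask 7 8 p3 p3 (found bare (7 ∷ 8 ∷ 5 ∷ 3 ∷ 2 ∷ 4 ∷ 6 ∷ 10 ∷ []) 9))) p3 (ask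 7 8 p3 p3 (found bare (7 ∷ 8 ∷ 5 ∷ 3 ∷ 2 ∷ 4 ∷ 6 ∷ 9 ∷ []) 8))) (ask 7 9 p3 (ask 7 10 p3 p3 (found bare (8 ∷ 5 ∷ 3 ∷ 2 ∷ 4 ∷ 6 ∷ 7 ∷ 10 ∷ []) 9)) (found bare (8 ∷ 5 ∷ 3 ∷ 2 ∷ 4 ∷ 6 ∷ 7 ∷ 9 ∷ []) 8)))) (ask 5 8 (ask 5 9 p3 p3 (ask 6 7 (ask 6 8 p3 (ask 6 10 p3 p3 (ask 7 9 p3 p3 (found (marked front red) (7 ∷ 9 ∷ 5 ∷ 3 ∷ 2 ∷ 4 ∷ 6 ∷ 10 ∷ []) 9))) (ask 7 8 p3 p3 (found bare (7 ∷ 8 ∷ 6 ∷ 4 ∷ 2 ∷ 3 ∷ 5 ∷ 9 ∷ []) 8))) p3 (ask 7 8 p3 p3 (found bare (8 ∷ 7 ∷ 6 ∷ 4 ∷ 2 ∷ 3 ∷ 5 ∷ 9 ∷ []) 8)))) p3 (ask 6 7 (ask 6 9 p3 (ask 6 10 p3 p3 (ask 7 8 p3 p3 (found bare (7 ∷ 8 ∷ 5 ∷ 3 ∷ 2 ∷ 4 ∷ 6 ∷ 10 ∷ []) 9))) (ask 7 8 p3 p3 (found bare (7 ∷ 8 ∷ 5 ∷ 3 ∷ 2 ∷ 4 ∷ 6 ∷ 9 ∷ []) 8))) p3 (ask 7 9 (ask 7 10 p3 p3 (found bare (8 ∷ 5 ∷ 3 ∷ 2 ∷ 4 ∷ 6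 ∷ 7 ∷ 10 ∷ []) 9)) p3 (found bare (8 ∷ 5 ∷ 3 ∷ 2 ∷ 4 ∷ 6 ∷ 7 ∷ 9 ∷ []) 8)))) (ask 6 8 (ask 6 9 p3 (ask 6 10 p3 p3 (ask 7 8 p3 (ask 7 9 (ask 10 8 p3 p3 (found (marked front red) (7 ∷ 5 ∷ 3 ∷ 2 ∷ 4 ∷ 6 ∷ 10 ∷ 8 ∷ []) 9)) p3 (found bare (9 ∷ 7 ∷ 5 ∷ 3 ∷ 2 ∷ 4 ∷ 6 ∷ 10 ∷ []) 9)) (found bare (8 ∷ 7 ∷ 5 ∷ 3 ∷ 2 ∷ 4 ∷ 6 ∷ 10 ∷ []) 9))) (ask 7 8 p3 (ask 7 10 (ask 7 11 p3 p3 (found bare (9 ∷ 6 ∷ 4 ∷ 2 ∷ 3 ∷ 5 ∷ 7 ∷ 11 ∷ []) 10)) p3 (found bare (9 ∷ 6 ∷ 4 ∷ 2 ∷ 3 ∷ 5 ∷ 7 ∷ 10 ∷ []) 9)) (found bare (8 ∷ 7 ∷ 5 ∷ 3 ∷ 2 ∷ 4 ∷ 6 ∷ 9 ∷ []) 8))) (ask 6 9 (ask 6 10 p3 p3 (ask 7 8 (ask 7 9 p3 (ask 10 8 p3 p3 (found (marked front red) (7 ∷ 5 ∷ 3 ∷ 2 ∷ 4 ∷ 6 ∷ 10 ∷ 8 ∷ []) 9)) (found bare (9 ∷ 7 ∷ 5 ∷ 3 ∷ 2 ∷ 4 ∷ 6 ∷ 10 ∷ []) 9)) p3 (found bare (8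 ∷ 7 ∷ 5 ∷ 3 ∷ 2 ∷ 4 ∷ 6 ∷ 10 ∷ []) 9))) p3 (ask 7 8 (ask 7 10 p3 (ask 7 11 p3 p3 (found bare (9 ∷ 6 ∷ 4 ∷ 2 ∷ 3 ∷ 5 ∷ 7 ∷ 11 ∷ []) 10)) (found bare (9 ∷ 6 ∷ 4 ∷ 2 ∷ 3 ∷ 5 ∷ 7 ∷ 10 ∷ []) 9)) p3 (found bare (8 ∷ 7 ∷ 5 ∷ 3 ∷ 2 ∷ 4 ∷ 6 ∷ 9 ∷ []) 8))) (ask 7 9 (ask 7 10 p3 (ask 7 11 p3 p3 (found bare (8 ∷ 6 ∷ 4 ∷ 2 ∷ 3 ∷ 5 ∷ 7 ∷ 11 ∷ []) 10)) (found bare (8 ∷ 6 ∷ 4 ∷ 2 ∷ 3 ∷ 5 ∷ 7 ∷ 10 ∷ []) 9)) (ask 7 10 (ask 7 11 p3 p3 (found bare (8 ∷ 6 ∷ 4 ∷ 2 ∷ 3 ∷ 5 ∷ 7 ∷ 11 ∷ []) 10)) p3 (found bare (8 ∷ 6 ∷ 4 ∷ 2 ∷ 3 ∷ 5 ∷ 7 ∷ 10 ∷ []) 9)) (found bare (8 ∷ 6 ∷ 4 ∷ 2 ∷ 3 ∷ 5 ∷ 7 ∷ 9 ∷ []) 8))))))))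

bareTree : Tree
bareTree = (ask 0 2 (ask 2 3 p3 (ask 0 3 p3 p3 (ask 1 2 p3 p3 (ask 3 4 (ask 2 4 p3 p3 (ask 3 5 p3 p3 (extend (marked back red) (5 ∷ 3 ∷ []) (2 ∷ 4 ∷ []) 4))) p3 (ask 2 5 p3 p3 (extend bare (4 ∷ 3 ∷ []) (2 ∷ 5 ∷ []) 4))))) (ask 0 4 p3 (ask 0 3 p3 p3 (ask 1 4 (ask 2 4 p3 p3 (ask 4 5 p3 p3 (extend (marked back red) (5 ∷ 4 ∷ 2 ∷ 3 ∷ []) [] 4))) p3 (ask 2 5 p3 (ask 2 6 p3 p3 (extend (marked back blue) (6 ∷ 2 ∷ 3 ∷ []) (4 ∷ []) 5)) (extend bare (5 ∷ 2 ∷ 3 ∷ []) (4 ∷ []) 4)))) (ask 1 3 (ask 1 5 p3 (ask 1 2 p3 p3 (ask 3 5 p3 p3 (extend (marked back blue) (4 ∷ []) (2 ∷ 3 ∷ 5 ∷ []) 4))) (ask 2 4 p3 (ask 2 5 p3 p3 (extend (marked front blue) (4 ∷ []) (5 ∷ 2 ∷ 3 ∷ []) 4)) (extend bare (3 ∷ 2 ∷ 4 ∷ []) (5 ∷ []) 4))) (ask 1 5 (ask 1 2 p3 p3 (ask 3 5 p3 p3 (extend (marked back red) (4 ∷ []) (2 ∷ 3 ∷ 5 ∷ []) 4))) p3 (ask 2 4 p3 (ask 2 5 p3 p3 (extend (marked front blue) (4 ∷ []) (5 ∷ 2 ∷ 3 ∷ []) 4)) (extend bare (3 ∷ 2 ∷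 4 ∷ []) (5 ∷ []) 4))) (ask 2 5 p3 (ask 2 6 p3 p3 (extend bare (4 ∷ []) (3 ∷ 2 ∷ 6 ∷ []) 5)) (extend bare (4 ∷ []) (3 ∷ 2 ∷ 5 ∷ []) 4))))) (ask 2 3 (ask 0 3 p3 p3 (ask 1 2 p3 p3 (ask 3 4 p3 (ask 2 4 p3 p3 (ask 3 5 p3 p3 (extend (marked back blue) (5 ∷ 3 ∷ []) (2 ∷ 4 ∷ []) 4))) (ask 2 5 p3 p3 (extend bare (4 ∷ 3 ∷ []) (2 ∷ 5 ∷ []) 4))))) p3 (ask 0 4 (ask 0 3 p3 p3 (ask 1 4 p3 (ask 2 4 p3 p3 (ask 4 5 p3 p3 (extend (marked back blue) (5 ∷ 4 ∷ 2 ∷ 3 ∷ []) [] 4))) (ask 2 5 (ask 2 6 p3 p3 (extend (marked back red) (6 ∷ 2 ∷ 3 ∷ []) (4 ∷ []) 5)) p3 (extend bare (5 ∷ 2 ∷ 3 ∷ []) (4 ∷ []) 4)))) p3 (ask 1 3 (ask 1 5 p3 (ask 1 2 p3 p3 (ask 3 5 p3 p3 (extend (marked back blue) (4 ∷ []) (2 ∷ 3 ∷ 5 ∷ []) 4))) (ask 2 4 (ask 2 5 p3 p3 (extend (marked front red) (4 ∷ []) (5 ∷ 2 ∷ 3 ∷ []) 4)) p3 (extend bare (3 ∷ 2 ∷ 4 ∷ []) (5 ∷ []) 4))) (ask 1 5 (ask 1 2 p3 p3 (ask 3 5 p3 p3 (extend (marked back red) (4 ∷ []) (2 ∷ 3 ∷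 5 ∷ []) 4))) p3 (ask 2 4 (ask 2 5 p3 p3 (extend (marked front red) (4 ∷ []) (5 ∷ 2 ∷ 3 ∷ []) 4)) p3 (extend bare (3 ∷ 2 ∷ 4 ∷ []) (5 ∷ []) 4))) (ask 2 5 (ask 2 6 p3 p3 (extend bare (4 ∷ []) (3 ∷ 2 ∷ 6 ∷ []) 5)) p3 (extend bare (4 ∷ []) (3 ∷ 2 ∷ 5 ∷ []) 4))))) (ask 1 3 (ask 1 4 p3 (ask 1 5 p3 p3 (ask 2 3 p3 (ask 5 3 p3 p3 (ask 3 4 p3 p3 (extend (marked front blue) (2 ∷ []) (5 ∷ 3 ∷ 4 ∷ []) 4))) (ask 3 4 p3 p3 (extend bare (4 ∷ 3 ∷ 2 ∷ []) (5 ∷ []) 4)))) (ask 2 3 p3 (ask 2 5 (ask 2 6 p3 p3 (ask 3 4 p3 p3 (extend (marked back red) (6 ∷ 2 ∷ []) (4 ∷ 3 ∷ []) 5))) p3 (ask 3 4 p3 p3 (extend bare (5 ∷ 2 ∷ []) (4 ∷ 3 ∷ []) 4))) (ask 3 5 p3 (ask 3 6 p3 p3 (extend bare (6 ∷ 3 ∷ 2 ∷ []) (4 ∷ []) 5)) (extend bare (5 ∷ 3 ∷ 2 ∷ []) (4 ∷ []) 4)))) (ask 1 4 (ask 1 5 p3 p3 (ask 2 3 (ask 5 3 p3 p3 (ask 3 4 p3 p3 (extend (marked front red) (2 ∷ []) (5 ∷ 3 ∷ 4 ∷ []) 4))) p3 (ask 3 4 p3 p3 (extend bare (4 ∷ 3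 ∷ 2 ∷ []) (5 ∷ []) 4)))) p3 (ask 2 3 (ask 2 5 p3 (ask 2 6 p3 p3 (ask 3 4 p3 p3 (extend (marked back red) (6 ∷ 2 ∷ []) (4 ∷ 3 ∷ []) 5))) (ask 3 4 p3 p3 (extend bare (5 ∷ 2 ∷ []) (4 ∷ 3 ∷ []) 4))) p3 (ask 3 5 (ask 3 6 p3 p3 (extend bare (6 ∷ 3 ∷ 2 ∷ []) (4 ∷ []) 5)) p3 (extend bare (5 ∷ 3 ∷ 2 ∷ []) (4 ∷ []) 4)))) (ask 2 4 (ask 2 5 p3 (ask 2 6 p3 p3 (ask 3 4 p3 (ask 6 4 p3 p3 (extend (marked front red) (4 ∷ 6 ∷ 2 ∷ []) (3 ∷ []) 5)) (extend bare (6 ∷ 2 ∷ []) (3 ∷ 4 ∷ []) 5))) (ask 3 4 p3 (ask 3 6 (ask 5 4 p3 p3 (extend (marked front red) (4 ∷ 5 ∷ 2 ∷ []) (3 ∷ []) 5)) p3 (extend bare (5 ∷ 2 ∷ []) (3 ∷ 6 ∷ []) 5)) (extend bare (5 ∷ 2 ∷ []) (3 ∷ 4 ∷ []) 4))) (ask 2 5 (ask 2 6 p3 p3 (ask 3 4 (ask 6 4 p3 p3 (extend (marked front red) (4 ∷ 6 ∷ 2 ∷ []) (3 ∷ []) 5)) p3 (extend bare (6 ∷ 2 ∷ []) (3 ∷ 4 ∷ []) 5))) p3 (ask 3 4 (ask 3 6 p3 (ask 5 4 p3 p3 (extend (marked front red) (4 ∷ 5 ∷ 2 ∷ []) (3 ∷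 []) 5)) (extend bare (5 ∷ 2 ∷ []) (3 ∷ 6 ∷ []) 5)) p3 (extend bare (5 ∷ 2 ∷ []) (3 ∷ 4 ∷ []) 4))) (ask 3 5 (ask 3 6 p3 (ask 3 7 p3 p3 (extend bare (4 ∷ 2 ∷ []) (3 ∷ 7 ∷ []) 6)) (extend bare (4 ∷ 2 ∷ []) (3 ∷ 6 ∷ []) 5)) (ask 3 6 (ask 3 7 p3 p3 (extend bare (4 ∷ 2 ∷ []) (3 ∷ 7 ∷ []) 6)) p3 (extend bare (4 ∷ 2 ∷ []) (3 ∷ 6 ∷ []) 5)) (extend bare (4 ∷ 2 ∷ []) (3 ∷ 5 ∷ []) 4)))))

frontRedTree : Tree
frontRedTree = (ask 2 3 (ask 2 4 p3 (ask 0 4 p3 p3 (ask 1 2 p3 p3 (ask 2 5 p3 p3 (ask 3 4 p3 p3 (extend (marked front red) (3 ∷ 4 ∷ []) (2 ∷ 5 ∷ []) 4))))) (ask 0 3 p3 (ask 0 4 p3 p3 (ask 1 3 p3 p3 (ask 3 5 p3 p3 (extend (marked front red) (2 ∷ 4 ∷ []) (3 ∷ 5 ∷ []) 4)))) (ask 3 5 p3 (ask 3 4 p3 p3 (ask 2 5 p3 p3 (extend (marked front blue) (5 ∷ 2 ∷ 4 ∷ 3 ∷ []) [] 4))) (ask 1 2 p3 (ask 5 2 p3 p3 (extend (marked back blue) (4 ∷ 2 ∷ 5 ∷ 3 ∷ []) [] 4)) (extend bare (5 ∷ 3 ∷ []) (2 ∷ 4 ∷ []) 4))))) (ask 0 2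 p3 p3 (ask 3 4 (ask 1 3 p3 p3 (ask 2 4 p3 p3 (ask 3 5 p3 p3 (extend (marked front red) (4 ∷ 2 ∷ []) (3 ∷ 5 ∷ []) 4)))) p3 (ask 2 5 (ask 2 4 p3 p3 (ask 3 5 p3 p3 (extend (marked front red) (5 ∷ 3 ∷ 4 ∷ 2 ∷ []) [] 4))) p3 (ask 1 3 (ask 5 3 p3 p3 (extend (marked back red) (4 ∷ 3 ∷ 5 ∷ 2 ∷ []) [] 4)) p3 (extend bare (5 ∷ 2 ∷ []) (3 ∷ 4 ∷ []) 4))))) (ask 1 4 (ask 0 4 p3 (ask 0 2 p3 p3 (ask 3 4 p3 p3 (ask 4 5 p3 p3 (extend (marked back red) (5 ∷ 4 ∷ 3 ∷ 2 ∷ []) [] 4)))) (ask 1 5 p3 (ask 1 2 p3 p3 (ask 4 5 p3 p3 (extend (marked front blue) (5 ∷ 4 ∷ []) (2 ∷ 3 ∷ []) 4))) (ask 2 4 p3 (ask 3 4 p3 p3 (extend (marked front blue) (2 ∷ 3 ∷ 4 ∷ []) (5 ∷ []) 4)) (extend bare (3 ∷ 2 ∷ 4 ∷ []) (5 ∷ []) 4)))) (ask 0 4 p3 p3 (ask 1 5 (ask 1 2 p3 p3 (ask 4 5 p3 p3 (extend (marked front red) (5 ∷ 4 ∷ []) (2 ∷ 3 ∷ []) 4))) p3 (ask 2 4 (ask 3 4 p3 p3 (extend (marked front red) (2 ∷ 3 ∷ 4 ∷ []) (5 ∷ []) 4)) p3 (extend bare (3 ∷ 2 ∷ 4 ∷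 []) (5 ∷ []) 4)))) (ask 4 2 (ask 0 3 p3 (ask 0 5 p3 p3 (ask 3 4 p3 p3 (extend (marked back red) (5 ∷ []) (4 ∷ 3 ∷ 2 ∷ []) 4))) (ask 2 5 p3 (ask 2 6 p3 p3 (extend (marked back red) (6 ∷ 2 ∷ 3 ∷ []) (4 ∷ []) 5)) (extend bare (5 ∷ 2 ∷ 3 ∷ []) (4 ∷ []) 4))) (ask 4 3 (ask 0 2 p3 p3 (ask 4 5 p3 p3 (extend (marked front red) (3 ∷ 2 ∷ []) (4 ∷ 5 ∷ []) 4))) p3 (ask 0 5 p3 (ask 0 6 p3 p3 (extend (marked back blue) (6 ∷ []) (4 ∷ 3 ∷ 2 ∷ []) 5)) (extend bare (5 ∷ []) (4 ∷ 3 ∷ 2 ∷ []) 4))) (ask 0 5 p3 (ask 0 6 p3 p3 (extend bare (6 ∷ []) (4 ∷ 2 ∷ 3 ∷ []) 5)) (extend bare (5 ∷ []) (4 ∷ 2 ∷ 3 ∷ []) 4)))))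

frontBlueTree : Tree
frontBlueTree = (ask 2 3 (ask 0 2 p3 p3 (ask 3 4 p3 (ask 1 3 p3 p3 (ask 2 4 p3 p3 (ask 3 5 p3 p3 (extend (marked front blue) (4 ∷ 2 ∷ []) (3 ∷ 5 ∷ []) 4)))) (ask 2 5 p3 (ask 2 4 p3 p3 (ask 3 5 p3 p3 (extend (marked front blue) (5 ∷ 3 ∷ 4 ∷ 2 ∷ []) [] 4))) (ask 1 3 p3 (ask 5 3 p3 p3 (extend (marked back blue) (4 ∷ 3 ∷ 5 ∷ 2 ∷ []) [] 4)) (extend bare (5 ∷ 2 ∷ []) (3 ∷ 4 ∷ []) 4))))) (ask 2 4 (ask 0 4 p3 p3 (ask 1 2 p3 p3 (ask 2 5 p3 p3 (ask 3 4 p3 p3 (extend (marked front blue) (3 ∷ 4 ∷ []) (2 ∷ 5 ∷ []) 4))))) p3 (ask 0 3 (ask 0 4 p3 p3 (ask 1 3 p3 p3 (ask 3 5 p3 p3 (extend (marked front blue) (2 ∷ 4 ∷ []) (3 ∷ 5 ∷ []) 4)))) p3 (ask 3 5 (ask 3 4 p3 p3 (ask 2 5 p3 p3 (extend (marked front red) (5 ∷ 2 ∷ 4 ∷ 3 ∷ []) [] 4))) p3 (ask 1 2 (ask 5 2 p3 p3 (extend (marked back red) (4 ∷ 2 ∷ 5 ∷ 3 ∷ []) [] 4)) p3 (extend bare (5 ∷ 3 ∷ []) (2 ∷ 4 ∷ []) 4))))) (ask 1 4 (ask 0 4 p3 p3 (ask 1 5 p3 (ask 1 2 p3 p3 (ask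 4 5 p3 p3 (extend (marked front blue) (5 ∷ 4 ∷ []) (2 ∷ 3 ∷ []) 4))) (ask 2 4 p3 (ask 3 4 p3 p3 (extend (marked front blue) (2 ∷ 3 ∷ 4 ∷ []) (5 ∷ []) 4)) (extend bare (3 ∷ 2 ∷ 4 ∷ []) (5 ∷ []) 4)))) (ask 0 4 (ask 0 2 p3 p3 (ask 3 4 p3 p3 (ask 4 5 p3 p3 (extend (marked back blue) (5 ∷ 4 ∷ 3 ∷ 2 ∷ []) [] 4)))) p3 (ask 1 5 (ask 1 2 p3 p3 (ask 4 5 p3 p3 (extend (marked front red) (5 ∷ 4 ∷ []) (2 ∷ 3 ∷ []) 4))) p3 (ask 2 4 (ask 3 4 p3 p3 (extend (marked front red) (2 ∷ 3 ∷ 4 ∷ []) (5 ∷ []) 4)) p3 (extend bare (3 ∷ 2 ∷ 4 ∷ []) (5 ∷ []) 4)))) (ask 4 2 (ask 4 3 p3 (ask 0 2 p3 p3 (ask 4 5 p3 p3 (extend (marked front blue) (3 ∷ 2 ∷ []) (4 ∷ 5 ∷ []) 4))) (ask 0 5 (ask 0 6 p3 p3 (extend (marked back red) (6 ∷ []) (4 ∷ 3 ∷ 2 ∷ []) 5)) p3 (extend bare (5 ∷ []) (4 ∷ 3 ∷ 2 ∷ []) 4))) (ask 0 3 (ask 0 5 p3 p3 (ask 3 4 p3 p3 (extend (marked back blue) (5 ∷ []) (4 ∷ 3 ∷ 2 ∷ []) 4))) p3 (ask 2 5 (ask 2 6 p3 p3 (extend (marked back blue) (6 ∷ 2 ∷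 3 ∷ []) (4 ∷ []) 5)) p3 (extend bare (5 ∷ 2 ∷ 3 ∷ []) (4 ∷ []) 4))) (ask 0 5 (ask 0 6 p3 p3 (extend bare (6 ∷ []) (4 ∷ 2 ∷ 3 ∷ []) 5)) p3 (extend bare (5 ∷ []) (4 ∷ 2 ∷ 3 ∷ []) 4)))))

backRedTree : Tree
backRedTree = (ask 2 3 (ask 2 4 p3 (ask 1 4 p3 p3 (ask 0 2 p3 p3 (ask 2 5 p3 p3 (ask 3 4 p3 p3 (extend (marked back red) (5 ∷ 2 ∷ []) (4 ∷ 3 ∷ []) 4))))) (ask 1 3 p3 (ask 1 4 p3 p3 (ask 0 3 p3 p3 (ask 3 5 p3 p3 (extend (marked back red) (5 ∷ 3 ∷ []) (4 ∷ 2 ∷ []) 4)))) (ask 3 5 p3 (ask 3 4 p3 p3 (ask 2 5 p3 p3 (extend (marked back blue) [] (3 ∷ 4 ∷ 2 ∷ 5 ∷ []) 4))) (ask 0 2 p3 (ask 5 2 p3 p3 (extend (marked front blue) [] (3 ∷ 5 ∷ 2 ∷ 4 ∷ []) 4)) (extend bare (4 ∷ 2 ∷ []) (3 ∷ 5 ∷ []) 4))))) (ask 1 2 p3 p3 (ask 3 4 (ask 0 3 p3 p3 (ask 2 4 p3 p3 (ask 3 5 p3 p3 (extend (marked back red) (5 ∷ 3 ∷ []) (2 ∷ 4 ∷ []) 4)))) p3 (ask 2 5 (ask 2 4 p3 p3 (ask 3 5 p3 p3 (extend (marked back red) [] (2 ∷ 4 ∷ 3 ∷ 5 ∷ []) 4)))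 p3 (ask 0 3 (ask 5 3 p3 p3 (extend (marked front red) [] (2 ∷ 5 ∷ 3 ∷ 4 ∷ []) 4)) p3 (extend bare (4 ∷ 3 ∷ []) (2 ∷ 5 ∷ []) 4))))) (ask 0 4 (ask 1 4 p3 (ask 1 2 p3 p3 (ask 3 4 p3 p3 (ask 4 5 p3 p3 (extend (marked front red) [] (2 ∷ 3 ∷ 4 ∷ 5 ∷ []) 4)))) (ask 0 5 p3 (ask 0 2 p3 p3 (ask 4 5 p3 p3 (extend (marked back blue) (3 ∷ 2 ∷ []) (4 ∷ 5 ∷ []) 4))) (ask 2 4 p3 (ask 3 4 p3 p3 (extend (marked back blue) (5 ∷ []) (4 ∷ 3 ∷ 2 ∷ []) 4)) (extend bare (5 ∷ []) (4 ∷ 2 ∷ 3 ∷ []) 4)))) (ask 1 4 p3 p3 (ask 0 5 (ask 0 2 p3 p3 (ask 4 5 p3 p3 (extend (marked back red) (3 ∷ 2 ∷ []) (4 ∷ 5 ∷ []) 4))) p3 (ask 2 4 (ask 3 4 p3 p3 (extend (marked back red) (5 ∷ []) (4 ∷ 3 ∷ 2 ∷ []) 4)) p3 (extend bare (5 ∷ []) (4 ∷ 2 ∷ 3 ∷ []) 4)))) (ask 4 2 (ask 1 3 p3 (ask 1 5 p3 p3 (ask 3 4 p3 p3 (extend (marked front red) (2 ∷ 3 ∷ 4 ∷ []) (5 ∷ []) 4))) (ask 2 5 p3 (ask 2 6 p3 p3 (extend (marked front red) (4 ∷ []) (3 ∷ 2 ∷ 6 ∷ []) 5)) (extend bare (4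 ∷ []) (3 ∷ 2 ∷ 5 ∷ []) 4))) (ask 4 3 (ask 1 2 p3 p3 (ask 4 5 p3 p3 (extend (marked back red) (5 ∷ 4 ∷ []) (2 ∷ 3 ∷ []) 4))) p3 (ask 1 5 p3 (ask 1 6 p3 p3 (extend (marked front blue) (2 ∷ 3 ∷ 4 ∷ []) (6 ∷ []) 5)) (extend bare (2 ∷ 3 ∷ 4 ∷ []) (5 ∷ []) 4))) (ask 1 5 p3 (ask 1 6 p3 p3 (extend bare (3 ∷ 2 ∷ 4 ∷ []) (6 ∷ []) 5)) (extend bare (3 ∷ 2 ∷ 4 ∷ []) (5 ∷ []) 4)))))

backBlueTree : Tree
backBlueTree = (ask 2 3 (ask 1 2 p3 p3 (ask 3 4 p3 (ask 0 3 p3 p3 (ask 2 4 p3 p3 (ask 3 5 p3 p3 (extend (marked back blue) (5 ∷ 3 ∷ []) (2 ∷ 4 ∷ []) 4)))) (ask 2 5 p3 (ask 2 4 p3 p3 (ask 3 5 p3 p3 (extend (marked back blue) [] (2 ∷ 4 ∷ 3 ∷ 5 ∷ []) 4))) (ask 0 3 p3 (ask 5 3 p3 p3 (extend (marked front blue) [] (2 ∷ 5 ∷ 3 ∷ 4 ∷ []) 4)) (extend bare (4 ∷ 3 ∷ []) (2 ∷ 5 ∷ []) 4))))) (ask 2 4 (ask 1 4 p3 p3 (ask 0 2 p3 p3 (ask 2 5 p3 p3 (ask 3 4 p3 p3 (extend (marked back blue) (5 ∷ 2 ∷ []) (4 ∷ 3 ∷ []) 4))))) p3 (ask 1 3 (ask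 1 4 p3 p3 (ask 0 3 p3 p3 (ask 3 5 p3 p3 (extend (marked back blue) (5 ∷ 3 ∷ []) (4 ∷ 2 ∷ []) 4)))) p3 (ask 3 5 (ask 3 4 p3 p3 (ask 2 5 p3 p3 (extend (marked back red) [] (3 ∷ 4 ∷ 2 ∷ 5 ∷ []) 4))) p3 (ask 0 2 (ask 5 2 p3 p3 (extend (marked front red) [] (3 ∷ 5 ∷ 2 ∷ 4 ∷ []) 4)) p3 (extend bare (4 ∷ 2 ∷ []) (3 ∷ 5 ∷ []) 4))))) (ask 0 4 (ask 1 4 p3 p3 (ask 0 5 p3 (ask 0 2 p3 p3 (ask 4 5 p3 p3 (extend (marked back blue) (3 ∷ 2 ∷ []) (4 ∷ 5 ∷ []) 4))) (ask 2 4 p3 (ask 3 4 p3 p3 (extend (marked back blue) (5 ∷ []) (4 ∷ 3 ∷ 2 ∷ []) 4)) (extend bare (5 ∷ []) (4 ∷ 2 ∷ 3 ∷ []) 4)))) (ask 1 4 (ask 1 2 p3 p3 (ask 3 4 p3 p3 (ask 4 5 p3 p3 (extend (marked front blue) [] (2 ∷ 3 ∷ 4 ∷ 5 ∷ []) 4)))) p3 (ask 0 5 (ask 0 2 p3 p3 (ask 4 5 p3 p3 (extend (marked back red) (3 ∷ 2 ∷ []) (4 ∷ 5 ∷ []) 4))) p3 (ask 2 4 (ask 3 4 p3 p3 (extend (marked back red) (5 ∷ []) (4 ∷ 3 ∷ 2 ∷ []) 4)) p3 (extend bare (5 ∷ []) (4 ∷ 2 ∷ 3 ∷ []) 4))))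 (ask 4 2 (ask 4 3 p3 (ask 1 2 p3 p3 (ask 4 5 p3 p3 (extend (marked back blue) (5 ∷ 4 ∷ []) (2 ∷ 3 ∷ []) 4))) (ask 1 5 (ask 1 6 p3 p3 (extend (marked front red) (2 ∷ 3 ∷ 4 ∷ []) (6 ∷ []) 5)) p3 (extend bare (2 ∷ 3 ∷ 4 ∷ []) (5 ∷ []) 4))) (ask 1 3 (ask 1 5 p3 p3 (ask 3 4 p3 p3 (extend (marked front blue) (2 ∷ 3 ∷ 4 ∷ []) (5 ∷ []) 4))) p3 (ask 2 5 (ask 2 6 p3 p3 (extend (marked front blue) (4 ∷ []) (3 ∷ 2 ∷ 6 ∷ []) 5)) p3 (extend bare (4 ∷ []) (3 ∷ 2 ∷ 5 ∷ []) 4))) (ask 1 5 (ask 1 6 p3 p3 (extend bare (3 ∷ 2 ∷ 4 ∷ []) (6 ∷ []) 5)) p3 (extend bare (3 ∷ 2 ∷ 4 ∷ []) (5 ∷ []) 4)))))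

root : Phase → Tree
root opening = openingTree
root (extending bare) = bareTree
root (extending (marked front red)) = frontRedTree
root (extending (marked front blue)) = frontBlueTree
root (extending (marked back red)) = backRedTree
root (extending (marked back blue)) = backBlueTree

root-valid : ∀ ph → Valid ph [] (root ph)
root-valid ph@opening = from-yes (valid? ph [] (root ph))
root-valid ph@(extending bare) = from-yes (valid? ph [] (root ph))
root-valid ph@(extending (marked front red)) = from-yes (valid? ph [] (root ph))
root-valid ph@(extending (marked front blue)) = from-yes (valid? ph [] (root ph))
root-valid ph@(extending (marked back red)) = from-yes (valid? ph [] (root ph))
root-valid ph@(extending (marked back blue)) = from-yes (valid? ph [] (root ph))

-- Transporting certificates to the board

Marking : Phase → Frame → Board → Set
Marking (extending (marked e c)) F b = Pendant b (paint c) (endpoint F e) (endpoint F e)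
Marking _ _ _ = ⊤

record Spine (F : Frame) (b : Board) (L : ℕ) : Set where
  constructor spine
  field
    vertices : List Vertex
    isPath : MonoPath b green vertices
    length≡ : length vertices ≡ L
    head≡ : head vertices ≡ just (start F)
    last≡ : last vertices ≡ just (finish F)
    old : All (_< fresh F) vertices

SpineAt : Phase → Frame → Board → ℕ → Set
SpineAt opening _ _ _ = ⊤
SpineAt (extending _) F b L = Spine F b L

grown : Phase → ℕ → ℕ
grown opening _ = 8
grown (extending _) L = L + 4

goodPath : ∀ {F b L} → Spine F b L → ∀ e → TouchesRedOrBlue b (endpoint F e) → HasGoodGreenPath b L
goodPath (spine vs path len head≡ _ _) front t = vs , path , len , _ , inj₁ head≡ , t
goodPath (spine vs path len _ last≡ _) back t = vs , path , len , _ , inj₂ last≡ , t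

goodOrBad : ∀ {F b L} → Spine F b L → (∃ λ e → TouchesRedOrBlue b (endpoint F e)) ⊎ HasBadGreenPath b L
goodOrBad {F} {b} (spine vs path len head≡ last≡ _)
  with touchesRedOrBlue? b (start F) | touchesRedOrBlue? b (finish F)
... | yes ts | _ = inj₁ (front , ts)
... | no _ | yes tf = inj₁ (back , tf)
... | no ¬ts | no ¬tf = inj₂ (vs , path , len , untouched)
  where
  untouched : ∀ x → IsEndpoint vs x → ¬ TouchesRedOrBlue b x
  untouched x (inj₁ h) = subst (¬_ ∘ TouchesRedOrBlue b) (just-injective (trans (sym head≡) h)) ¬ts
  untouched x (inj₂ h) = subst (¬_ ∘ TouchesRedOrBlue b) (just-injective (trans (sym last≡) h)) ¬tf

pendant⇒touches : ∀ {b x} c → Pendant b (paint c) x x → TouchesRedOrBlue b x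
pendant⇒touches red (y , _ , e) = inj₁ (y , e)
pendant⇒touches blue (y , _ , e) = inj₂ (y , e)

module Realise {F : Frame} (ok : FrameOK F) {b₀ : Board} (below : VerticesBelow (fresh F) b₀) where

  ρ : ℕ → Vertex
  ρ = vertexAt F

  realise : Board → Board
  realise lb = embed F lb ++ b₀

  ρ-≢ : ∀ {i j} → i ≢ j → ρ i ≢ ρ j
  ρ-≢ i≢j = i≢j ∘ vertexAt-injective ok

  old⊆realise : ∀ lb → b₀ ⊆ realise lb
  old⊆realise lb = ∈-++⁺ʳ (embed F lb)

  HasEdge-realise : ∀ {lb c i j} → HasEdge lb c i j → HasEdge (realise lb) c (ρ i) (ρ j)
  HasEdge-realise (inj₁ e) = inj₁ (∈-++⁺ˡ (∈-map⁺ _ e))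
  HasEdge-realise (inj₂ e) = inj₂ (∈-++⁺ˡ (∈-map⁺ _ e))

  Pendant-realise : ∀ {lb c x z} → Pendant lb c x z → Pendant (realise lb) c (ρ x) (ρ z)
  Pendant-realise (y , (y≢x , y≢z) , e) = ρ y , (ρ-≢ y≢x , ρ-≢ y≢z) , HasEdge-realise e

  Linked-realise : ∀ {lb xs} → Linked (HasEdge lb green) xs → Linked (HasEdge (realise lb) green) (map ρ xs)
  Linked-realise = Linked.map⁺ ∘ Linked.map HasEdge-realise

  Unique-realise : ∀ {xs} → Unique xs → Unique (map ρ xs)
  Unique-realise = Unique.map⁺ (vertexAt-injective ok)

  edge-origin : ∀ {lb i j c} → (ρ i , ρ j , c) ∈ realise lb → (i , j , c) ∈ lb ⊎ (i < 2 × j < 2)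
  edge-origin {lb} {i} {j} e with ∈-++⁻ (embed F lb) e
  ... | inj₂ e₀ = inj₂ (vertexAt-old F (proj₁ (below e₀)) , vertexAt-old F (proj₂ (below e₀)))
  ... | inj₁ e′ with ∈-map⁻ _ e′
  ...   | (a , b , _) , e″ , eq
    with vertexAt-injective ok {i} {a} (cong proj₁ eq) | vertexAt-injective ok {j} {b} (cong (proj₁ ∘ proj₂) eq)
       | cong (proj₂ ∘ proj₂) eq
  ...   | refl | refl | refl = inj₁ e″

  Legal-realise : ∀ {lb i j} → Legal lb i j → ¬ (i < 2 × j < 2) → Legal (realise lb) (ρ i) (ρ j)
  Legal-realise (i≢j , ¬adjacent) notOld = ρ-≢ i≢j , λ where
      (c , inj₁ e) → [ (λ e′ → ¬adjacent (c , inj₁ e′)) , notOld ]′ (edge-origin e)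
      (c , inj₂ e) → [ (λ e′ → ¬adjacent (c , inj₂ e′)) , notOld ∘ swap ]′ (edge-origin e)

  below-realise : ∀ {m lb} → All (Within m) lb → VerticesBelow (fresh F + m) (realise lb)
  below-realise {m} {lb} within e with ∈-++⁻ (embed F lb) e
  ... | inj₂ e₀ = let (u< , v<) = below e₀ in <-≤-trans u< (m≤m+n _ m) , <-≤-trans v< (m≤m+n _ m)
  ... | inj₁ e′ with ∈-map⁻ _ e′
  ...   | _ , e″ , refl = let (i< , j<) = All.lookup within e″ in vertexAt-< ok i< , vertexAt-< ok j<

  markedAt-realise : ∀ {ph x c} → Marking ph F b₀ → MarkedAt ph x c → Pendant b₀ c (ρ x) (ρ x)
  markedAt-realise {extending (marked front _)} p (refl , refl) = p
  markedAt-realise {extending (marked back _)} p (refl , refl) = p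

  touches-realise : ∀ {ph lb x c} → Marking ph F b₀ → Touches ph lb x c → Pendant (realise lb) c (ρ x) (ρ x)
  touches-realise {lb = lb} mk (inj₁ m) = Pendant-⊆ (old⊆realise lb) (markedAt-realise mk m)
  touches-realise mk (inj₂ p) = Pendant-realise p

  -- Old neighbours lie below fresh F, so they avoid every new vertex.
  markedAt-avoids : ∀ {ph lb x z c} → Marking ph F b₀ → MarkedAt ph x c → 2 ≤ z → Pendant (realise lb) c (ρ x) (ρ z)
  markedAt-avoids {lb = lb} mk m 2≤z with markedAt-realise mk m
  ... | y , (y≢x , _) , e =
    y , (y≢x , <⇒≢ (<-≤-trans (proj₂ (HasEdge-below below e)) (vertexAt-fresh F 2≤z))) , HasEdge-⊆ (old⊆realise lb) e

  closes-realise : ∀ {ph lb i j c} → Marking ph F b₀ → ClosesP3 ph lb i j c →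
    Pendant (realise lb) c (ρ i) (ρ j) ⊎ Pendant (realise lb) c (ρ j) (ρ i)
  closes-realise mk (inj₁ p) = inj₁ (Pendant-realise p)
  closes-realise mk (inj₂ (inj₁ p)) = inj₂ (Pendant-realise p)
  closes-realise mk (inj₂ (inj₂ (inj₁ (m , 2≤j)))) = inj₁ (markedAt-avoids mk m 2≤j)
  closes-realise mk (inj₂ (inj₂ (inj₂ (m , 2≤i)))) = inj₂ (markedAt-avoids mk m 2≤i)

  P3-realise : ∀ {ph lb i j c} → Marking ph F b₀ → i ≢ j → ClosesP3 ph lb i j c →
    HasMonoPath ((ρ i , ρ j , c) ∷ realise lb) c 3
  P3-realise mk i≢j closes with closes-realise mk closes
  ... | inj₁ p = pendant⇒P3 (ρ-≢ i≢j) (Pendant-⊆ there p) (inj₁ (here refl))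
  ... | inj₂ p = pendant⇒P3 (ρ-≢ (≢-sym i≢j)) (Pendant-⊆ there p) (inj₂ (here refl))

  nextFrame-ok : ∀ {s f m} → s ≢ f → s < 2 + m → f < 2 + m → FrameOK (nextFrame F s f m)
  nextFrame-ok s≢f s< f< = ρ-≢ s≢f , vertexAt-< ok s< , vertexAt-< ok f<

  marking-realise : ∀ {ph lb s f m k} → Marking ph F b₀ → Justified ph lb s f k →
    Marking (extending k) (nextFrame F s f m) (realise lb)
  marking-realise {k = bare} _ _ = tt
  marking-realise {k = marked front _} mk j = touches-realise mk j
  marking-realise {k = marked back _} mk j = touches-realise mk j

  new-below : ∀ {m xs} → All (Fresh m) xs → All (_< fresh F + m) (map ρ xs)
  new-below = All.map⁺ ∘ All.map (vertexAt-< ok ∘ proj₂)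

  new-fresh : ∀ {m xs v} → All (Fresh m) xs → v ∈ map ρ xs → fresh F ≤ v
  new-fresh fs v∈ with ∈-map⁻ _ v∈
  ... | _ , i∈ , refl = vertexAt-fresh F (proj₁ (All.lookup fs i∈))

  old-below : ∀ {m vs} → All (_< fresh F) vs → All (_< fresh F + m) vs
  old-below {m} = All.map λ v< → <-≤-trans v< (m≤m+n _ m)

  extendSpine : ∀ {L m lb pre suf} → Spine F b₀ L → Extension m lb pre suf →
    Spine (nextFrame F (headOr 0 pre) (lastOr 1 suf) m) (realise lb) (L + 4)
  extendSpine {L} {m} {lb} {pre} {suf} (spine (v ∷ vs) (uniq , linked) len refl last≡ old)
    (fpre , fsuf , upre , usuf , pre#suf , lpre , lsuf , 4≡) =
    spine (pre′ ++ (v ∷ vs) ++ suf′) (unique , linked′) length′ (head-map-++ ρ pre refl) last′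
      (All.++⁺ (new-below fpre) (All.++⁺ (old-below old) (new-below fsuf)))
    where
    pre′ = map ρ pre
    suf′ = map ρ suf
    old#new : ∀ {xs} → All (Fresh m) xs → Disjoint (v ∷ vs) (map ρ xs)
    old#new fs (w∈old , w∈new) = <⇒≱ (All.lookup old w∈old) (new-fresh fs w∈new)
    pre#rest : Disjoint pre′ ((v ∷ vs) ++ suf′)
    pre#rest (w∈pre , w∈rest) with ∈-++⁻ (v ∷ vs) w∈rest
    ... | inj₁ w∈old = old#new fpre (w∈old , w∈pre)
    ... | inj₂ w∈suf with ∈-map⁻ ρ w∈pre | ∈-map⁻ ρ w∈suf
    ...   | a , a∈pre , refl | _ , b∈suf , ρa≡ρb =
      pre#suf (a∈pre , subst (_∈ suf) (sym (vertexAt-injective ok ρa≡ρb)) b∈suf)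
    unique : Unique (pre′ ++ (v ∷ vs) ++ suf′)
    unique = Unique.++⁺ (Unique-realise upre) (Unique.++⁺ uniq (Unique-realise usuf) (old#new fsuf)) pre#rest
    linked′ : Linked (HasEdge (realise lb) green) (pre′ ++ (v ∷ vs) ++ suf′)
    linked′ = Linked-glueˡ pre′ (subst (Linked _) (map-++ ρ pre (0 ∷ [])) (Linked-realise lpre))
      (Linked-glueʳ (Linked.map (HasEdge-⊆ (old⊆realise lb)) linked) last≡ (Linked-realise lsuf))
    length′ : length (pre′ ++ (v ∷ vs) ++ suf′) ≡ L + 4
    length′ = begin
      length (pre′ ++ (v ∷ vs) ++ suf′)              ≡⟨ length-++ pre′ ⟩
      length pre′ + length ((v ∷ vs) ++ suf′)        ≡⟨ cong (length pre′ +_) (length-++ (v ∷ vs)) ⟩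
      length pre′ + (length (v ∷ vs) + length suf′)  ≡⟨ cong₂ (λ a b → a + (length (v ∷ vs) + b))
                                                           (length-map ρ pre) (length-map ρ suf) ⟩
      length pre + (length (v ∷ vs) + length suf)    ≡⟨ cong (λ l → length pre + (l + length suf)) len ⟩
      length pre + (L + length suf)                  ≡⟨ x∙yz≈y∙xz (length pre) L (length suf) ⟩
      L + (length pre + length suf)                  ≡⟨ cong (L +_) 4≡ ⟩
      L + 4                                          ∎
      where open ≡-Reasoning
    last′ : last (pre′ ++ (v ∷ vs) ++ suf′) ≡ just (ρ (lastOr 1 suf))
    last′ = trans (cong last (sym (++-assoc pre′ (v ∷ vs) suf′)))
      (last-++-map ρ (pre′ ++ v ∷ vs) suf (last-++ pre′ last≡))

  freshSpine : ∀ {m lb p ps} → FreshPath m lb (p ∷ ps) → Spine (nextFrame F p (lastOr p ps) m) (realise lb) 8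
  freshSpine {p = p} {ps} (fs , uniq , linked , len) =
    spine (map ρ (p ∷ ps)) (Unique-realise uniq , Linked-realise linked) (trans (length-map ρ (p ∷ ps)) len)
      refl (last-++-map ρ (ρ p ∷ []) ps refl) (new-below fs)

-- Builder reads the whole history off the board: replaying the colours of its edges through the
-- trees recovers the current phase, frame and position in the tree.
data Control : Set where
  state : Phase → Frame → Tree → Control

settle : Phase → Frame → Tree → Control
settle _ F (extend k pre suf m) = state (extending k) (nextFrame F (headOr 0 pre) (lastOr 1 suf) m) (root (extending k))
settle _ F (found k path m) = state (extending k) (nextFrame F (headOr 0 path) (lastOr 0 path) m) (root (extending k))
settle ph F tr = state ph F tr

settle-root : ∀ ph F → settle ph F (root ph) ≡ state ph F (root ph)
settle-root opening F = refl
settle-root (extending bare) F = refl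
settle-root (extending (marked front red)) F = refl
settle-root (extending (marked front blue)) F = refl
settle-root (extending (marked back red)) F = refl
settle-root (extending (marked back blue)) F = refl

pick : Colour → Tree → Tree → Tree → Tree
pick red r _ _ = r
pick blue _ b _ = b
pick green _ _ g = g

respond : Control → Colour → Control
respond (state ph F (ask _ _ r b g)) c = settle ph F (pick c r b g)
respond s _ = s

control : Board → Control
control [] = state opening (mkFrame 0 1 2) (root opening)
control ((_ , _ , c) ∷ b) = respond (control b) c

proposal : Control → Maybe (Vertex × Vertex)
proposal (state _ F (ask i j _ _ _)) = just (vertexAt F i , vertexAt F j)
proposal _ = nothing

builder : BuilderStrategy
builder b with proposal (control b)
... | nothing = freshMove b
... | just (u , v) with legal? b u v
...   | yes legal = (u , v) , legal
...   | no _ = freshMove b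

builder-follows : ∀ b {u v} → proposal (control b) ≡ just (u , v) → Legal b u v → proj₁ (builder b) ≡ (u , v)
builder-follows b p legal with proposal (control b) | p
... | just (u , v) | refl with legal? b u v
...   | yes _ = refl
...   | no ¬legal = ⊥-elim (¬legal legal)

play-step : ∀ P t {u v} → proj₁ (builder (play builder P t)) ≡ (u , v) →
  play builder P (suc t) ≡ (u , v , P (play builder P t) (u , v)) ∷ play builder P t
play-step P t eq rewrite eq = refl

-- The play against a fixed Painter

deadline : ∀ {t t₀ n x B} → t ≡ t₀ + n → n + x ≤ B → t + x ≤ t₀ + B
deadline {t₀ = t₀} {n} {x} {B} refl n+x≤B = subst (_≤ t₀ + B) (sym (+-assoc t₀ n x)) (+-monoʳ-≤ t₀ n+x≤B)

nextDeadline : ∀ t′ x t s j → t′ + x ≤ t + (s + 6) → t + s ≤ 6 * j → t′ + x ≤ 6 * suc j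
nextDeadline t′ x t s j h h′ = begin
  t′ + x        ≤⟨ h ⟩
  t + (s + 6)   ≡⟨ sym (+-assoc t s 6) ⟩
  t + s + 6     ≤⟨ +-monoˡ-≤ 6 h′ ⟩
  6 * j + 6     ≡⟨ +-comm (6 * j) 6 ⟩
  6 + 6 * j     ≡⟨ sym (*-suc 6 j) ⟩
  6 * suc j     ∎
  where open ≤-Reasoning

module Game (P : PainterStrategy) where

  board : ℕ → Board
  board = play builder P

  record PhaseStart (ph : Phase) (L t : ℕ) : Set where
    constructor phaseStart
    field
      frame : Frame
      controlled : control (board t) ≡ state ph frame (root ph)
      frameOK : FrameOK frame
      below : VerticesBelow (fresh frame) (board t)
      marking : Marking ph frame (board t)
      spineAt : SpineAt ph frame (board t) L

  restart : ∀ {ph F L t b} → board t ≡ b → control (board t) ≡ state ph F (root ph) →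
    FrameOK F → VerticesBelow (fresh F) b → Marking ph F b → SpineAt ph F b L → PhaseStart ph L t
  restart refl = phaseStart _

  opening-start : PhaseStart opening 0 0
  opening-start = phaseStart (mkFrame 0 1 2) refl ((λ ()) , s≤s z≤n , s≤s (s≤s z≤n)) (λ ()) tt tt

  PhaseOutcome : Phase → ℕ → ℕ → Set
  PhaseOutcome ph t₀ L = (∃ λ t → t + 1 ≤ t₀ + budget ph × RedOrBlueP3 (board t))
    ⊎ (∃₂ λ t k → PhaseStart (extending k) L t × t + slack k ≤ t₀ + budget ph)

  leafStart : ∀ {ph L t₀ lb s f m k t L′} (ps : PhaseStart ph L t₀) → let F = PhaseStart.frame ps in
    Leaf ph lb s f m k → s < 2 + m → f < 2 + m → board t ≡ embed F lb ++ board t₀ →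
    control (board t) ≡ state (extending k) (nextFrame F s f m) (root (extending k)) →
    Spine (nextFrame F s f m) (embed F lb ++ board t₀) L′ → PhaseStart (extending k) L′ t
  leafStart ps (_ , within , s≢f , justified) s< f< realised steered sp =
    restart realised steered (nextFrame-ok s≢f s< f<) (below-realise within) (marking-realise marking justified) sp
    where
    open PhaseStart ps
    open Realise frameOK below

  -- lb lists the moves of the current phase so far, in local indices; tr is what remains of its tree.
  follow : ∀ {ph L t₀} (ps : PhaseStart ph L t₀) lb tr t → Valid ph lb tr → t ≡ t₀ + length lb →
    board t ≡ embed (PhaseStart.frame ps) lb ++ board t₀ → control (board t) ≡ settle ph (PhaseStart.frame ps) tr →
    PhaseOutcome ph t₀ (grown ph L)
  follow {ph} {L} {t₀} ps lb (ask i j onRed onBlue onGreen) t (legal , valid-r , valid-b , valid-g) elapsed realised steered =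
    continue (P (board t) (ρ i , ρ j)) refl
    where
    open PhaseStart ps
    open Realise frameOK below
    moved : board (suc t) ≡ (ρ i , ρ j , P (board t) (ρ i , ρ j)) ∷ board t
    moved = play-step P t (builder-follows (board t) (cong proposal steered)
      (subst (λ b → Legal b (ρ i) (ρ j)) (sym realised) (Legal-realise (proj₁ legal) (proj₂ legal))))
    elapsed′ : suc t ≡ t₀ + suc (length lb)
    elapsed′ = trans (cong suc elapsed) (sym (+-suc t₀ (length lb)))
    realised′ : ∀ {c} → P (board t) (ρ i , ρ j) ≡ c → board (suc t) ≡ realise ((i , j , c) ∷ lb)
    realised′ painted = trans moved (cong₂ (λ c b → (ρ i , ρ j , c) ∷ b) painted realised)
    steered′ : ∀ {c} → P (board t) (ρ i , ρ j) ≡ c → control (board (suc t)) ≡ settle ph frame (pick c onRed onBlue onGreen)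
    steered′ painted = trans (cong control moved) (cong₂ respond steered painted)
    continue : ∀ c → P (board t) (ρ i , ρ j) ≡ c → PhaseOutcome ph t₀ (grown ph L)
    continue red painted = follow ps ((i , j , red) ∷ lb) onRed (suc t) valid-r elapsed′ (realised′ painted) (steered′ painted)
    continue blue painted = follow ps ((i , j , blue) ∷ lb) onBlue (suc t) valid-b elapsed′ (realised′ painted) (steered′ painted)
    continue green painted = follow ps ((i , j , green) ∷ lb) onGreen (suc t) valid-g elapsed′ (realised′ painted) (steered′ painted)
  follow ps [] p3 t (_ , ())
  follow ps ((i , j , c) ∷ lb) p3 t (inTime , i≢j , c≢green , closes) elapsed realised _ =
    inj₁ (t , deadline elapsed inTime , subst RedOrBlueP3 (sym realised) (redOrBlueP3 c≢green (P3-realise marking i≢j closes)))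
    where
    open PhaseStart ps
    open Realise frameOK below
  follow {extending _} ps lb (extend k pre suf m) t (extension , leaf) elapsed realised steered =
    inj₂ (t , k , leafStart ps leaf start< end< realised steered (extendSpine spineAt extension) , deadline elapsed (proj₁ leaf))
    where
    open PhaseStart ps
    open Realise frameOK below
    start< = headOr-All pre (s≤s z≤n) (All.map proj₂ (proj₁ extension))
    end< = lastOr-All suf (s≤s (s≤s z≤n)) (All.map proj₂ (proj₁ (proj₂ extension)))
  follow {opening} ps lb (found k (p ∷ qs) m) t (freshPath , leaf) elapsed realised steered =
    inj₂ (t , k , leafStart ps leaf p< end< realised steered (freshSpine freshPath) , deadline elapsed (proj₁ leaf))
    where
    open PhaseStart ps
    open Realise frameOK below
    p< = proj₂ (All.head (proj₁ freshPath))
    end< = lastOr-All qs p< (All.map proj₂ (All.tail (proj₁ freshPath)))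
  follow {opening} ps lb (found k [] m) t ((_ , _ , _ , ()) , _)

  phase : ∀ {ph L t₀} → PhaseStart ph L t₀ → PhaseOutcome ph t₀ (grown ph L)
  phase {ph} {t₀ = t₀} ps =
    follow ps [] (root ph) t₀ (root-valid ph) (sym (+-identityʳ t₀)) refl (trans controlled (sym (settle-root ph frame)))
    where open PhaseStart ps

  Reached : ℕ → Set
  Reached j = (∃ λ t → t + 1 ≤ 6 * j × RedOrBlueP3 (board t))
    ⊎ (∃₂ λ t k → PhaseStart (extending k) (4 * j) t × t + slack k ≤ 6 * j)

  advance : ∀ {j} → Reached j → Reached (suc j)
  advance {j} (inj₁ (t , bound , p)) = inj₁ (t , ≤-trans bound (*-monoʳ-≤ 6 (n≤1+n j)) , p)
  advance {j} (inj₂ (t , k , ps , bound)) with phase ps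
  ... | inj₁ (t′ , bound′ , p) = inj₁ (t′ , nextDeadline t′ 1 t (slack k) j bound′ bound , p)
  ... | inj₂ (t′ , k′ , ps′ , bound′) = inj₂ (t′ , k′ , subst (λ L → PhaseStart (extending k′) L t′) 4j+4≡ ps′ ,
      nextDeadline t′ (slack k′) t (slack k) j bound′ bound)
    where
    4j+4≡ : 4 * j + 4 ≡ 4 * suc j
    4j+4≡ = trans (+-comm (4 * j) 4) (sym (*-suc 4 j))

  reached : ∀ n → Reached (2 + n)
  reached zero = phase opening-start
  reached (suc n) = advance {2 + n} (reached n)

  conclude : ∀ {k} → Reached k →
    (∃ λ t → t ≤ 6 * k ∸ 1 × RedOrBlueP3 (board t))
      ⊎ (∃ λ t → t ≤ 6 * k ∸ 2 × HasBadGreenPath (board t) (4 * k))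
      ⊎ (∃ λ t → t ≤ 6 * k ∸ 1 × HasGoodGreenPath (board t) (4 * k))
  conclude (inj₁ (t , bound , p)) = inj₁ (t , m+n≤o⇒m≤o∸n t bound , p)
  conclude (inj₂ (t , marked e c , ps , bound)) =
    inj₂ (inj₂ (t , m+n≤o⇒m≤o∸n t bound , goodPath (PhaseStart.spineAt ps) e (pendant⇒touches c (PhaseStart.marking ps))))
  conclude (inj₂ (t , bare , ps , bound)) with goodOrBad (PhaseStart.spineAt ps)
  ... | inj₁ (e , touches) =
    inj₂ (inj₂ (t , m+n≤o⇒m≤o∸n t (≤-trans (+-monoʳ-≤ t (s≤s z≤n)) bound) , goodPath (PhaseStart.spineAt ps) e touches))
  ... | inj₂ bad = inj₂ (inj₁ (t , m+n≤o⇒m≤o∸n t bound , bad))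

theorem3p5 : (k : ℕ) → 2 ≤ k →
    Σ BuilderStrategy λ B → (P : PainterStrategy) →
      (∃ λ t → t ≤ 6 * k ∸ 1 ×
         (HasMonoPath (play B P t) red 3 ⊎ HasMonoPath (play B P t) blue 3))
      ⊎ (∃ λ t → t ≤ 6 * k ∸ 2 × HasBadGreenPath (play B P t) (4 * k))
      ⊎ (∃ λ t → t ≤ 6 * k ∸ 1 × HasGoodGreenPath (play B P t) (4 * k))
theorem3p5 (suc (suc n)) (s≤s (s≤s z≤n)) = builder , λ P → Game.conclude P {2 + n} (Game.reached P n)
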